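{- For all positive integers $n$ and $k$, \[ D_{2n}^{(-2k)}\equiv 0\pmod{2^{2n}}. \]
   Context: For $k\in\mathbb{Z}$ and $|z|<1$, let $\mathrm{Li}_k(z)=\sum_{n\ge1}z^n/n^k$ and $\mathrm{A}_k(z)=\mathrm{Li}_k(z)-\mathrm{Li}_k(-z)$. The polycosecant numbers $D_n^{(k)}$ are defined by \[ \frac{\mathrm{A}_k(\tanh(t/2))}{\sinh t}=\sum_{n\ge0}D_n^{(k)}\frac{t^n}{n!}. \] For $k\le0$ these are integers. -}

module Defs where

-- Formal power series over ℚ, represented by their coefficient sequences
-- (ordinary, not exponential, coefficients): f(t) = Σ_{n≥0} f n · t^n.

open import Data.Nat as ℕ using (ℕ; zero; suc; _!)
open import Data.Nat.Properties using (m^n≢0; _!≢0)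
open import Data.Integer as ℤ using (ℤ; +_; -[1+_])
open import Data.Rational using (ℚ; 0ℚ; 1ℚ; _+_; _*_; -_; _-_; _/_)
open import Data.List using (List; []; _∷_; zipWith; upTo; map; foldr)

Series : Set
Series = ℕ → ℚ

ℕ→ℚ : ℕ → ℚ
ℕ→ℚ n = (+ n) / 1

sumℚ : List ℚ → ℚ
sumℚ = foldr _+_ 0ℚ

Σ≤ : ℕ → (ℕ → ℚ) → ℚ
Σ≤ n f = sumℚ (map f (upTo (suc n)))

sgn : ℕ → ℚ
sgn zero = 1ℚ
sgn (suc n) = - sgn n

half^ : ℕ → ℚ
half^ zero = 1ℚ
half^ (suc n) = ((+ 1) / 2) * half^ n

_⊕_ : Series → Series → Series
(f ⊕ g) n = f n + g n

_⊖_ : Series → Series → Series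
(f ⊖ g) n = f n - g n

scale : ℚ → Series → Series
scale c f n = c * f n

_⊛_ : Series → Series → Series
(f ⊛ g) n = Σ≤ n (λ i → f i * g (n ℕ.∸ i))

negArg : Series → Series
negArg f n = sgn n * f n

halfArg : Series → Series
halfArg f n = half^ n * f n

-- f(t)/t, for f with zero constant term
divT : Series → Series
divT f n = f (suc n)

one : Series
one zero = 1ℚ
one (suc n) = 0ℚ

pow : Series → ℕ → Series
pow T zero = one
pow T (suc m) = T ⊛ pow T m

-- composition a(T(t)), valid when T has zero constant term:
-- the coefficient of t^n only involves a_0,…,a_n
compose : Series → Series → Series
compose a T n = Σ≤ n (λ m → a m * pow T m n)

-- multiplicative inverse of a series g with constant term 1:
-- b_0 = 1, b_n = - Σ_{i=1}^{n} g_i b_{n-i}.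
-- invRev g n = [b_n, b_{n-1}, …, b_0]
invRev : Series → ℕ → List ℚ
invRev g zero = 1ℚ ∷ []
invRev g (suc n) =
  let rs = invRev g n
  in (- sumℚ (zipWith (λ j b → g (suc j) * b) (upTo (suc n)) rs)) ∷ rs

inv₁ : Series → Series
inv₁ g n with invRev g n
... | b ∷ _ = b
... | [] = 0ℚ

-- quotient f / g for g with constant term 1
_⊘₁_ : Series → Series → Series
f ⊘₁ g = f ⊛ inv₁ g

expS : Series
expS n = _/_ (+ 1) (n !) ⦃ n !≢0 ⦄

sinhS : Series
sinhS = scale ((+ 1) / 2) (expS ⊖ negArg expS)

coshS : Series
coshS = scale ((+ 1) / 2) (expS ⊕ negArg expS)

-- tanh(t/2) = sinh(t/2) / cosh(t/2)   (cosh(t/2) has constant term 1)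
tanhHalf : Series
tanhHalf = halfArg sinhS ⊘₁ halfArg coshS

-- polylogarithm Li_k(z) = Σ_{n≥1} z^n / n^k, for k ∈ ℤ
Li : ℤ → Series
Li k zero = 0ℚ
Li (+ m) (suc j) = _/_ (+ 1) (suc j ℕ.^ m) ⦃ m^n≢0 (suc j) m ⦄
Li -[1+ m ] (suc j) = (+ (suc j ℕ.^ suc m)) / 1

A : ℤ → Series
A k = Li k ⊖ negArg (Li k)

-- polycosecant numbers:
--   A_k(tanh(t/2)) / sinh t = Σ_{n≥0} D_n^{(k)} t^n / n!
-- Both numerator and sinh t have zero constant term; we divide both by t,
-- after which sinh(t)/t has constant term 1.
D : ℕ → ℤ → ℚ
D n k = ℕ→ℚ (n !) * (divT (compose (A k) tanhHalf) ⊘₁ divT sinhS) n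

ℤ→ℚ : ℤ → ℚ
ℤ→ℚ z = z / 1

module Submission where

-- For T = tanh(t/2) one has sinh t · T′ = T, and A_{-m-1}(z) = z A_{-m}′(z), so
-- F_m = A_{-m}(T) satisfies F_{m+1} = sinh t · F_m′ by the chain rule. With
-- F_0 = A_0(T) = 2T/(1 − T²) = sinh t this gives F_m = sinh t · P_m, where P_0 = 1 and
-- P_{m+1} = cosh t · P_m + sinh t · P_m′, so D_n^{(-m)} = n! [tⁿ] P_m. Unfolding the
-- recursion twice and using the double-angle formulas yields P_{2k}(t) = Q_k(2t) for a
-- series Q_k built from cosh, sinh, integers and derivatives. Series with integral
-- n! [tⁿ] are closed under sums, products and derivatives, so n! [tⁿ] Q_k ∈ ℤ and
-- D_n^{(-2k)} = 2ⁿ · n! [tⁿ] Q_k.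

module Polycosecant where

  open import Defs
  open import Algebra.Bundles using (CommutativeMonoid; CommutativeRing)
  import Algebra.Properties.CommutativeSemigroup as CommutativeSemigroupProperties
  import Algebra.Solver.Ring
  import Algebra.Solver.Ring.AlmostCommutativeRing as ACR
  open import Data.List using (_∷_; map; applyUpTo; upTo; zipWith)
  open import Data.Maybe using (Maybe; just; nothing)
  open import Data.Nat as ℕ using (ℕ; zero; suc; _∸_; _!; _^_)
  import Data.Nat.Properties as ℕ
  open import Data.Integer as ℤ using (+_)
  import Data.Integer.Properties as ℤ
  import Data.Integer.Solver as ℤ-Solver
  open import Data.Product using (_×_; _,_; proj₁; proj₂; ∃-syntax)
  open import Data.Rational as ℚ using (ℚ; 0ℚ; 1ℚ; ½; _+_; _*_; -_; _-_; _/_; toℚᵘ; 1/_)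
  open import Data.Rational.Base using (+-*-rawRing)
  open import Data.Rational.Properties
  import Data.Rational.Unnormalised as ℚᵘ
  import Data.Rational.Unnormalised.Properties as ℚᵘ
  import Data.Rational.Solver as ℚ-Solver
  open import Function using (id)
  open import Relation.Nullary using (yes; no)
  open import Relation.Binary.PropositionalEquality
  import Relation.Binary.Reasoning.Setoid as SetoidReasoning

  module ℚ-Ring = ℚ-Solver.+-*-Solver
  module ℚ-+ = CommutativeSemigroupProperties (CommutativeMonoid.commutativeSemigroup +-0-commutativeMonoid)
  module ℚ-* = CommutativeSemigroupProperties (CommutativeMonoid.commutativeSemigroup *-1-commutativeMonoid)

  toℚᵘ-ℤ→ℚ : ∀ z → toℚᵘ (ℤ→ℚ z) ℚᵘ.≃ ℚᵘ.mkℚᵘ z 0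
  toℚᵘ-ℤ→ℚ z = toℚᵘ-fromℚᵘ (ℚᵘ.mkℚᵘ z 0)

  ℤ→ℚ-+ : ∀ a b → ℤ→ℚ (a ℤ.+ b) ≡ ℤ→ℚ a + ℤ→ℚ b
  ℤ→ℚ-+ a b = toℚᵘ-injective (ℚᵘ.≃-trans (toℚᵘ-ℤ→ℚ (a ℤ.+ b)) (ℚᵘ.≃-trans (ℚᵘ.*≡* same)
    (ℚᵘ.≃-sym (ℚᵘ.≃-trans (toℚᵘ-homo-+ (ℤ→ℚ a) (ℤ→ℚ b))
      (ℚᵘ.+-cong (toℚᵘ-ℤ→ℚ a) (toℚᵘ-ℤ→ℚ b))))))
    where
    open ℤ-Solver.+-*-Solver
    same : (a ℤ.+ b) ℤ.* (+ 1 ℤ.* + 1) ≡ (a ℤ.* + 1 ℤ.+ b ℤ.* + 1) ℤ.* + 1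
    same = solve 2 (λ a b → (a :+ b) :* (con (+ 1) :* con (+ 1))
                          := (a :* con (+ 1) :+ b :* con (+ 1)) :* con (+ 1)) refl a b

  ℤ→ℚ-* : ∀ a b → ℤ→ℚ (a ℤ.* b) ≡ ℤ→ℚ a * ℤ→ℚ b
  ℤ→ℚ-* a b = toℚᵘ-injective (ℚᵘ.≃-trans (toℚᵘ-ℤ→ℚ (a ℤ.* b)) (ℚᵘ.≃-trans (ℚᵘ.*≡* same)
    (ℚᵘ.≃-sym (ℚᵘ.≃-trans (toℚᵘ-homo-* (ℤ→ℚ a) (ℤ→ℚ b))
      (ℚᵘ.*-cong (toℚᵘ-ℤ→ℚ a) (toℚᵘ-ℤ→ℚ b))))))
    where
    open ℤ-Solver.+-*-Solver
    same : (a ℤ.* b) ℤ.* (+ 1 ℤ.* + 1) ≡ (a ℤ.* b) ℤ.* + 1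
    same = solve 2 (λ a b → (a :* b) :* (con (+ 1) :* con (+ 1))
                          := (a :* b) :* con (+ 1)) refl a b

  ℤ→ℚ-neg : ∀ z → ℤ→ℚ (ℤ.- z) ≡ - ℤ→ℚ z
  ℤ→ℚ-neg z = begin
    ℤ→ℚ (ℤ.- z)             ≡⟨ cong ℤ→ℚ (sym (ℤ.-1*i≡-i z)) ⟩
    ℤ→ℚ (ℤ.- + 1 ℤ.* z)     ≡⟨ ℤ→ℚ-* (ℤ.- + 1) z ⟩
    - 1ℚ * ℤ→ℚ z            ≡⟨ neg-distribˡ-* 1ℚ (ℤ→ℚ z) ⟨
    - (1ℚ * ℤ→ℚ z)          ≡⟨ cong -_ (*-identityˡ (ℤ→ℚ z)) ⟩
    - ℤ→ℚ z                 ∎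
    where open ≡-Reasoning

  ℕ→ℚ-+ : ∀ a b → ℕ→ℚ (a ℕ.+ b) ≡ ℕ→ℚ a + ℕ→ℚ b
  ℕ→ℚ-+ a b = trans (cong ℤ→ℚ (ℤ.pos-+ a b)) (ℤ→ℚ-+ (+ a) (+ b))

  ℕ→ℚ-* : ∀ a b → ℕ→ℚ (a ℕ.* b) ≡ ℕ→ℚ a * ℕ→ℚ b
  ℕ→ℚ-* a b = trans (cong ℤ→ℚ (ℤ.pos-* a b)) (ℤ→ℚ-* (+ a) (+ b))

  ℕ→ℚ-suc : ∀ n → ℕ→ℚ (suc n) ≡ ℕ→ℚ n + 1ℚ
  ℕ→ℚ-suc n = trans (cong ℕ→ℚ (ℕ.+-comm 1 n)) (ℕ→ℚ-+ n 1)

  ℕ→ℚ-*-cancelˡ : ∀ n {p q} → ℕ→ℚ (suc n) * p ≡ ℕ→ℚ (suc n) * q → p ≡ q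
  ℕ→ℚ-*-cancelˡ n {p} {q} eq = begin
    p                   ≡⟨ sym (*-identityˡ p) ⟩
    1ℚ * p              ≡⟨ cong (_* p) (sym (*-inverseˡ x)) ⟩
    (1/ x) * x * p      ≡⟨ *-assoc (1/ x) x p ⟩
    (1/ x) * (x * p)    ≡⟨ cong ((1/ x) *_) eq ⟩
    (1/ x) * (x * q)    ≡⟨ sym (*-assoc (1/ x) x q) ⟩
    (1/ x) * x * q      ≡⟨ cong (_* q) (*-inverseˡ x) ⟩
    1ℚ * q              ≡⟨ *-identityˡ q ⟩
    q                   ∎
    where
    open ≡-Reasoning
    x = ℕ→ℚ (suc n)
    instance
      x≢0 : ℚ.NonZero x
      x≢0 = pos⇒nonZero x {{normalize-pos (suc n) 1}}

  -- Finite sums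

  ∑ : ℕ → (ℕ → ℚ) → ℚ
  ∑ zero    f = 0ℚ
  ∑ (suc n) f = f 0 + ∑ n (λ i → f (suc i))

  infix 6.5 ∑
  syntax ∑ n (λ i → e) = ∑[ i < n ] e

  Σ≤-∑ : ∀ n f → Σ≤ n f ≡ ∑ (suc n) f
  Σ≤-∑ n f = go (suc n) id
    where
    go : ∀ m (g : ℕ → ℕ) → sumℚ (map f (applyUpTo g m)) ≡ ∑[ i < m ] f (g i)
    go zero    g = refl
    go (suc m) g = cong (_+_ (f (g 0))) (go m (λ i → g (suc i)))

  ∑-cong-< : ∀ n {f g : ℕ → ℚ} → (∀ i → i ℕ.< n → f i ≡ g i) → ∑ n f ≡ ∑ n g
  ∑-cong-< zero    eq = refl
  ∑-cong-< (suc n) eq = cong₂ _+_ (eq 0 (ℕ.s≤s ℕ.z≤n)) (∑-cong-< n (λ i i<n → eq (suc i) (ℕ.s≤s i<n)))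

  ∑-cong : ∀ n {f g : ℕ → ℚ} → (∀ i → f i ≡ g i) → ∑ n f ≡ ∑ n g
  ∑-cong n eq = ∑-cong-< n (λ i _ → eq i)

  ∑-zero : ∀ n {f} → (∀ i → i ℕ.< n → f i ≡ 0ℚ) → ∑ n f ≡ 0ℚ
  ∑-zero zero    eq = refl
  ∑-zero (suc n) eq = trans (cong₂ _+_ (eq 0 (ℕ.s≤s ℕ.z≤n)) (∑-zero n (λ i i<n → eq (suc i) (ℕ.s≤s i<n))))
                            (+-identityˡ 0ℚ)

  ∑-+ : ∀ n f g → ∑[ i < n ] (f i + g i) ≡ ∑ n f + ∑ n g
  ∑-+ zero    f g = refl
  ∑-+ (suc n) f g = trans (cong (_+_ (f 0 + g 0)) (∑-+ n _ _)) (ℚ-+.interchange (f 0) (g 0) _ _)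

  ∑-*ˡ : ∀ n c f → ∑[ i < n ] (c * f i) ≡ c * ∑ n f
  ∑-*ˡ zero    c f = sym (*-zeroʳ c)
  ∑-*ˡ (suc n) c f = trans (cong (_+_ (c * f 0)) (∑-*ˡ n c _)) (sym (*-distribˡ-+ c (f 0) _))

  ∑-*ʳ : ∀ n c f → ∑[ i < n ] (f i * c) ≡ ∑ n f * c
  ∑-*ʳ n c f = trans (∑-cong n (λ i → *-comm (f i) c)) (trans (∑-*ˡ n c f) (*-comm c _))

  ∑-last : ∀ n f → ∑ (suc n) f ≡ ∑ n f + f n
  ∑-last zero    f = trans (+-identityʳ (f 0)) (sym (+-identityˡ (f 0)))
  ∑-last (suc n) f = trans (cong (_+_ (f 0)) (∑-last n _)) (sym (+-assoc (f 0) _ _))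

  ∑-comm : ∀ n m (F : ℕ → ℕ → ℚ) → ∑[ i < n ] ∑[ j < m ] F i j ≡ ∑[ j < m ] ∑[ i < n ] F i j
  ∑-comm zero    m F = sym (∑-zero m (λ _ _ → refl))
  ∑-comm (suc n) m F = trans (cong (_+_ (∑ m (F 0))) (∑-comm n m _)) (sym (∑-+ m _ _))

  ∑-extend : ∀ n m f → n ℕ.≤ m → (∀ i → n ℕ.≤ i → f i ≡ 0ℚ) → ∑ m f ≡ ∑ n f
  ∑-extend n m f n≤m tail with ℕ.m≤n⇒∃[o]m+o≡n n≤m
  ... | k , refl = go k
    where
    go : ∀ k → ∑ (n ℕ.+ k) f ≡ ∑ n f
    go zero    = cong (λ m → ∑ m f) (ℕ.+-identityʳ n)
    go (suc k) = begin
      ∑ (n ℕ.+ suc k) f            ≡⟨ cong (λ m → ∑ m f) (ℕ.+-suc n k) ⟩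
      ∑ (suc (n ℕ.+ k)) f          ≡⟨ ∑-last (n ℕ.+ k) f ⟩
      ∑ (n ℕ.+ k) f + f (n ℕ.+ k)  ≡⟨ cong₂ _+_ (go k) (tail _ (ℕ.m≤m+n n k)) ⟩
      ∑ n f + 0ℚ                   ≡⟨ +-identityʳ _ ⟩
      ∑ n f                        ∎
      where open ≡-Reasoning

  -- Formal power series

  -- A record rather than ∀ n → f n ≡ g n, so that f and g stay inferable
  -- from the type of an equation.
  infix 4 _≋_
  record _≋_ (f g : Series) : Set where
    constructor pointwise
    field at : ∀ n → f n ≡ g n
  open _≋_ public

  ≋-refl : ∀ {f} → f ≋ f
  ≋-refl = pointwise λ _ → refl

  ≋-reflexive : ∀ {f g} → f ≡ g → f ≋ g
  ≋-reflexive refl = ≋-refl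

  ≋-sym : ∀ {f g} → f ≋ g → g ≋ f
  ≋-sym f≋g = pointwise λ n → sym (at f≋g n)

  ≋-trans : ∀ {f g h} → f ≋ g → g ≋ h → f ≋ h
  ≋-trans f≋g g≋h = pointwise λ n → trans (at f≋g n) (at g≋h n)

  0ₛ : Series
  0ₛ _ = 0ℚ

  infix 25 ⊝_
  ⊝_ : Series → Series
  (⊝ f) n = - f n

  const : ℚ → Series
  const c = scale c one

  const-zero : const 0ℚ ≋ 0ₛ
  const-zero = pointwise λ n → *-zeroˡ (one n)

  ∂ : Series → Series
  ∂ f n = ℕ→ℚ (suc n) * f (suc n)

  ⊛-coeff : ∀ f g n → (f ⊛ g) n ≡ ∑[ i < suc n ] f i * g (n ∸ i)
  ⊛-coeff f g n = Σ≤-∑ n (λ i → f i * g (n ∸ i))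

  ⊛-cong : ∀ {f f′ g g′} → f ≋ f′ → g ≋ g′ → f ⊛ g ≋ f′ ⊛ g′
  ⊛-cong {f} {f′} {g} {g′} f≋f′ g≋g′ = pointwise λ n → begin
    (f ⊛ g) n                           ≡⟨ ⊛-coeff f g n ⟩
    ∑[ i < suc n ] f i * g (n ∸ i)      ≡⟨ ∑-cong (suc n) (λ i → cong₂ _*_ (at f≋f′ i) (at g≋g′ (n ∸ i))) ⟩
    ∑[ i < suc n ] f′ i * g′ (n ∸ i)    ≡⟨ ⊛-coeff f′ g′ n ⟨
    (f′ ⊛ g′) n                         ∎
    where open ≡-Reasoning

  ⊛-congˡ : ∀ f {g g′} → g ≋ g′ → f ⊛ g ≋ f ⊛ g′
  ⊛-congˡ f = ⊛-cong (≋-refl {f})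

  ⊛-congʳ : ∀ g {f f′} → f ≋ f′ → f ⊛ g ≋ f′ ⊛ g
  ⊛-congʳ g f≋f′ = ⊛-cong f≋f′ (≋-refl {g})

  ⊛-distribˡ-⊕ : ∀ f g h → f ⊛ (g ⊕ h) ≋ (f ⊛ g) ⊕ (f ⊛ h)
  ⊛-distribˡ-⊕ f g h = pointwise λ n → begin
    (f ⊛ (g ⊕ h)) n
      ≡⟨ ⊛-coeff f (g ⊕ h) n ⟩
    ∑[ i < suc n ] f i * (g (n ∸ i) + h (n ∸ i))
      ≡⟨ ∑-cong (suc n) (λ i → *-distribˡ-+ (f i) (g (n ∸ i)) (h (n ∸ i))) ⟩
    ∑[ i < suc n ] (f i * g (n ∸ i) + f i * h (n ∸ i))
      ≡⟨ ∑-+ (suc n) (λ i → f i * g (n ∸ i)) (λ i → f i * h (n ∸ i)) ⟩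
    ∑[ i < suc n ] f i * g (n ∸ i) + ∑[ i < suc n ] f i * h (n ∸ i)
      ≡⟨ cong₂ _+_ (⊛-coeff f g n) (⊛-coeff f h n) ⟨
    (f ⊛ g) n + (f ⊛ h) n
      ∎
    where open ≡-Reasoning

  ⊛-scaleˡ : ∀ c f g → scale c f ⊛ g ≋ scale c (f ⊛ g)
  ⊛-scaleˡ c f g = pointwise λ n → begin
    (scale c f ⊛ g) n                      ≡⟨ ⊛-coeff (scale c f) g n ⟩
    ∑[ i < suc n ] c * f i * g (n ∸ i)     ≡⟨ ∑-cong (suc n) (λ i → *-assoc c (f i) (g (n ∸ i))) ⟩
    ∑[ i < suc n ] c * (f i * g (n ∸ i))   ≡⟨ ∑-*ˡ (suc n) c (λ i → f i * g (n ∸ i)) ⟩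
    c * (∑[ i < suc n ] f i * g (n ∸ i))   ≡⟨ cong (c *_) (⊛-coeff f g n) ⟨
    c * (f ⊛ g) n                          ∎
    where open ≡-Reasoning

  ⊛-identityˡ : ∀ f → one ⊛ f ≋ f
  ⊛-identityˡ f = pointwise λ n → begin
    (one ⊛ f) n
      ≡⟨ ⊛-coeff one f n ⟩
    1ℚ * f n + ∑[ i < n ] 0ℚ * f (n ∸ suc i)
      ≡⟨ cong₂ _+_ (*-identityˡ (f n)) (∑-zero n (λ i _ → *-zeroˡ (f (n ∸ suc i)))) ⟩
    f n + 0ℚ
      ≡⟨ +-identityʳ (f n) ⟩
    f n
      ∎
    where open ≡-Reasoning

  const-⊛ : ∀ c f → const c ⊛ f ≋ scale c f
  const-⊛ c f = pointwise λ n → trans (at (⊛-scaleˡ c one f) n) (cong (c *_) (at (⊛-identityˡ f) n))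

  const-+ : ∀ a b → const (a + b) ≋ const a ⊕ const b
  const-+ a b = pointwise λ n → *-distribʳ-+ (one n) a b

  const-* : ∀ a b → const (a * b) ≋ const a ⊛ const b
  const-* a b = pointwise λ n → trans (*-assoc a b (one n)) (sym (at (const-⊛ a (const b)) n))

  ∂-cong : ∀ {f g} → f ≋ g → ∂ f ≋ ∂ g
  ∂-cong f≋g = pointwise λ n → cong (ℕ→ℚ (suc n) *_) (at f≋g (suc n))

  -- The Leibniz rule: the weight n + 1 of a coefficient of f ⊛ g splits as i + (n + 1 − i).
  ∂-⊛ : ∀ f g → ∂ (f ⊛ g) ≋ (∂ f ⊛ g) ⊕ (f ⊛ ∂ g)
  ∂-⊛ f g = pointwise coeff
    where
    open ≡-Reasoning
    coeff : ∀ n → ∂ (f ⊛ g) n ≡ (∂ f ⊛ g) n + (f ⊛ ∂ g) n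
    coeff n = begin
      ℕ→ℚ (suc n) * (f ⊛ g) (suc n)                  ≡⟨ cong (ℕ→ℚ (suc n) *_) (⊛-coeff f g (suc n)) ⟩
      ℕ→ℚ (suc n) * ∑ (suc (suc n)) term              ≡⟨ ∑-*ˡ (suc (suc n)) (ℕ→ℚ (suc n)) term ⟨
      ∑[ i < suc (suc n) ] ℕ→ℚ (suc n) * term i       ≡⟨ ∑-cong-< (suc (suc n)) split ⟩
      ∑[ i < suc (suc n) ] (left i + right i)         ≡⟨ ∑-+ (suc (suc n)) left right ⟩
      ∑ (suc (suc n)) left + ∑ (suc (suc n)) right    ≡⟨ cong₂ _+_ left-sum right-sum ⟩
      (∂ f ⊛ g) n + (f ⊛ ∂ g) n                       ∎
      where
      term left right : ℕ → ℚ
      term  i = f i * g (suc n ∸ i)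
      left  i = ℕ→ℚ i * term i
      right i = ℕ→ℚ (suc n ∸ i) * term i

      split : ∀ i → i ℕ.< suc (suc n) → ℕ→ℚ (suc n) * term i ≡ left i + right i
      split i i<2+n = begin
        ℕ→ℚ (suc n) * term i                       ≡⟨ cong (λ m → ℕ→ℚ m * term i) (ℕ.m+[n∸m]≡n (ℕ.≤-pred i<2+n)) ⟨
        ℕ→ℚ (i ℕ.+ (suc n ∸ i)) * term i           ≡⟨ cong (_* term i) (ℕ→ℚ-+ i (suc n ∸ i)) ⟩
        (ℕ→ℚ i + ℕ→ℚ (suc n ∸ i)) * term i         ≡⟨ *-distribʳ-+ (term i) (ℕ→ℚ i) (ℕ→ℚ (suc n ∸ i)) ⟩
        left i + right i                           ∎

      left-sum : ∑ (suc (suc n)) left ≡ (∂ f ⊛ g) n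
      left-sum = begin
        0ℚ * term 0 + ∑[ i < suc n ] left (suc i)
          ≡⟨ cong (_+ ∑ (suc n) (λ i → left (suc i))) (*-zeroˡ (term 0)) ⟩
        0ℚ + ∑[ i < suc n ] left (suc i)
          ≡⟨ +-identityˡ (∑ (suc n) (λ i → left (suc i))) ⟩
        ∑[ i < suc n ] left (suc i)
          ≡⟨ ∑-cong (suc n) (λ i → sym (*-assoc (ℕ→ℚ (suc i)) (f (suc i)) (g (n ∸ i)))) ⟩
        ∑[ i < suc n ] ∂ f i * g (n ∸ i)
          ≡⟨ ⊛-coeff (∂ f) g n ⟨
        (∂ f ⊛ g) n
          ∎

      right-sum : ∑ (suc (suc n)) right ≡ (f ⊛ ∂ g) n
      right-sum = begin
        ∑ (suc (suc n)) right                       ≡⟨ ∑-last (suc n) right ⟩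
        ∑ (suc n) right + right (suc n)             ≡⟨ cong (_+_ (∑ (suc n) right)) last≡0 ⟩
        ∑ (suc n) right + 0ℚ                        ≡⟨ +-identityʳ (∑ (suc n) right) ⟩
        ∑ (suc n) right                             ≡⟨ ∑-cong-< (suc n) reindex ⟩
        ∑[ i < suc n ] f i * ∂ g (n ∸ i)            ≡⟨ ⊛-coeff f (∂ g) n ⟨
        (f ⊛ ∂ g) n                                 ∎
        where
        last≡0 : right (suc n) ≡ 0ℚ
        last≡0 = trans (cong (λ m → ℕ→ℚ m * (f (suc n) * g m)) (ℕ.n∸n≡0 n)) (*-zeroˡ (f (suc n) * g 0))
        reindex : ∀ i → i ℕ.< suc n → right i ≡ f i * ∂ g (n ∸ i)
        reindex i i<1+n rewrite ℕ.+-∸-assoc 1 (ℕ.≤-pred i<1+n) =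
          ℚ-*.x∙yz≈y∙xz (ℕ→ℚ (suc (n ∸ i))) (f i) (g (suc (n ∸ i)))

  ∂-injective : ∀ {f g} → f 0 ≡ g 0 → ∂ f ≋ ∂ g → f ≋ g
  ∂-injective f₀≡g₀ ∂f≋∂g = pointwise λ where
    zero    → f₀≡g₀
    (suc n) → ℕ→ℚ-*-cancelˡ n (at ∂f≋∂g n)

  -- Commutativity and associativity by induction on the coefficient index: the
  -- Leibniz rule reduces index n + 1 of a product to index n of products.
  ⊛-comm : ∀ f g → f ⊛ g ≋ g ⊛ f
  ⊛-comm f g = pointwise (go f g)
    where
    go : ∀ f g n → (f ⊛ g) n ≡ (g ⊛ f) n
    go f g zero    = cong (_+ 0ℚ) (*-comm (f 0) (g 0))
    go f g (suc n) = ℕ→ℚ-*-cancelˡ n (begin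
      ∂ (f ⊛ g) n                   ≡⟨ at (∂-⊛ f g) n ⟩
      (∂ f ⊛ g) n + (f ⊛ ∂ g) n     ≡⟨ cong₂ _+_ (go (∂ f) g n) (go f (∂ g) n) ⟩
      (g ⊛ ∂ f) n + (∂ g ⊛ f) n     ≡⟨ +-comm ((g ⊛ ∂ f) n) ((∂ g ⊛ f) n) ⟩
      (∂ g ⊛ f) n + (g ⊛ ∂ f) n     ≡⟨ at (∂-⊛ g f) n ⟨
      ∂ (g ⊛ f) n                   ∎)
      where open ≡-Reasoning

  ⊛-distribʳ-⊕ : ∀ h f g → (f ⊕ g) ⊛ h ≋ (f ⊛ h) ⊕ (g ⊛ h)
  ⊛-distribʳ-⊕ h f g = ≋-trans (⊛-comm (f ⊕ g) h)
    (≋-trans (⊛-distribˡ-⊕ h f g) (pointwise λ n → cong₂ _+_ (at (⊛-comm h f) n) (at (⊛-comm h g) n)))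

  ⊛-assoc : ∀ f g h → (f ⊛ g) ⊛ h ≋ f ⊛ (g ⊛ h)
  ⊛-assoc f g h = pointwise (go f g h)
    where
    go : ∀ f g h n → ((f ⊛ g) ⊛ h) n ≡ (f ⊛ (g ⊛ h)) n
    go f g h zero    = ℚ-Ring.solve 3 (λ a b c → (a :* b :+ con 0ℚ) :* c :+ con 0ℚ
                                              := a :* (b :* c :+ con 0ℚ) :+ con 0ℚ) refl (f 0) (g 0) (h 0)
      where open ℚ-Ring
    go f g h (suc n) = ℕ→ℚ-*-cancelˡ n (begin
      ∂ ((f ⊛ g) ⊛ h) n
        ≡⟨ at (∂-⊛ (f ⊛ g) h) n ⟩
      (∂ (f ⊛ g) ⊛ h) n + ((f ⊛ g) ⊛ ∂ h) n
        ≡⟨ cong (_+ ((f ⊛ g) ⊛ ∂ h) n) (at (≋-trans (⊛-congʳ h (∂-⊛ f g)) distribʳ) n) ⟩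
      (((∂ f ⊛ g) ⊛ h) n + ((f ⊛ ∂ g) ⊛ h) n) + ((f ⊛ g) ⊛ ∂ h) n
        ≡⟨ cong₂ _+_ (cong₂ _+_ (go (∂ f) g h n) (go f (∂ g) h n)) (go f g (∂ h) n) ⟩
      ((∂ f ⊛ (g ⊛ h)) n + (f ⊛ (∂ g ⊛ h)) n) + (f ⊛ (g ⊛ ∂ h)) n
        ≡⟨ +-assoc ((∂ f ⊛ (g ⊛ h)) n) ((f ⊛ (∂ g ⊛ h)) n) ((f ⊛ (g ⊛ ∂ h)) n) ⟩
      (∂ f ⊛ (g ⊛ h)) n + ((f ⊛ (∂ g ⊛ h)) n + (f ⊛ (g ⊛ ∂ h)) n)
        ≡⟨ cong (_+_ ((∂ f ⊛ (g ⊛ h)) n)) (at (≋-trans (⊛-congˡ f (∂-⊛ g h)) (⊛-distribˡ-⊕ f (∂ g ⊛ h) (g ⊛ ∂ h))) n) ⟨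
      (∂ f ⊛ (g ⊛ h)) n + (f ⊛ ∂ (g ⊛ h)) n
        ≡⟨ at (∂-⊛ f (g ⊛ h)) n ⟨
      ∂ (f ⊛ (g ⊛ h)) n
        ∎)
      where
      open ≡-Reasoning
      distribʳ : ((∂ f ⊛ g) ⊕ (f ⊛ ∂ g)) ⊛ h ≋ ((∂ f ⊛ g) ⊛ h) ⊕ ((f ⊛ ∂ g) ⊛ h)
      distribʳ = ⊛-distribʳ-⊕ h (∂ f ⊛ g) (f ⊛ ∂ g)

  series-commutativeRing : CommutativeRing _ _
  series-commutativeRing = record
    { Carrier = Series ; _≈_ = _≋_ ; _+_ = _⊕_ ; _*_ = _⊛_ ; -_ = ⊝_ ; 0# = 0ₛ ; 1# = one
    ; isCommutativeRing = record
      { isRing = record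
        { +-isAbelianGroup = record
          { isGroup = record
            { isMonoid = record
              { isSemigroup = record
                { isMagma = record
                  { isEquivalence = record { refl = ≋-refl ; sym = ≋-sym ; trans = ≋-trans }
                  ; ∙-cong = λ p q → pointwise λ n → cong₂ _+_ (at p n) (at q n) }
                ; assoc = λ f g h → pointwise λ n → +-assoc (f n) (g n) (h n) }
              ; identity = (λ f → pointwise λ n → +-identityˡ (f n))
                         , (λ f → pointwise λ n → +-identityʳ (f n)) }
            ; inverse = (λ f → pointwise λ n → +-inverseˡ (f n))
                      , (λ f → pointwise λ n → +-inverseʳ (f n))
            ; ⁻¹-cong = λ p → pointwise λ n → cong -_ (at p n) }
          ; comm = λ f g → pointwise λ n → +-comm (f n) (g n) }
        ; *-cong = ⊛-cong
        ; *-assoc = ⊛-assoc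
        ; *-identity = ⊛-identityˡ , (λ f → ≋-trans (⊛-comm f one) (⊛-identityˡ f))
        ; distrib = ⊛-distribˡ-⊕ , ⊛-distribʳ-⊕ }
      ; *-comm = ⊛-comm } }

  open CommutativeRing series-commutativeRing public
    using () renaming (setoid to ≋-setoid; +-cong to ⊕-cong; -‿cong to ⊝-cong; *-identityʳ to ⊛-identityʳ)

  ⊕-congˡ : ∀ f {g g′} → g ≋ g′ → f ⊕ g ≋ f ⊕ g′
  ⊕-congˡ f = ⊕-cong (≋-refl {f})

  ⊕-congʳ : ∀ g {f f′} → f ≋ f′ → f ⊕ g ≋ f′ ⊕ g
  ⊕-congʳ g f≋f′ = ⊕-cong f≋f′ (≋-refl {g})

  const-morphism : +-*-rawRing ACR.-Raw-AlmostCommutative⟶ ACR.fromCommutativeRing series-commutativeRing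
  const-morphism = record
    { ⟦_⟧    = const
    ; +-homo = const-+
    ; *-homo = const-*
    ; -‿homo = λ a → pointwise λ n → sym (neg-distribˡ-* a (one n))
    ; 0-homo = pointwise λ n → *-zeroˡ (one n)
    ; 1-homo = pointwise λ n → *-identityˡ (one n) }

  _≟const_ : ∀ a b → Maybe (const a ≋ const b)
  a ≟const b with a ≟ b
  ... | yes refl = just ≋-refl
  ... | no _     = nothing

  -- Rational constants enter the series ring through const, so the ring
  -- solver also handles identities with rational coefficients.
  module Series-Solver =
    Algebra.Solver.Ring +-*-rawRing (ACR.fromCommutativeRing series-commutativeRing) const-morphism _≟const_

  module ≋-Reasoning = SetoidReasoning ≋-setoid

  ∂-⊕ : ∀ f g → ∂ (f ⊕ g) ≋ ∂ f ⊕ ∂ g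
  ∂-⊕ f g = pointwise λ n → *-distribˡ-+ (ℕ→ℚ (suc n)) (f (suc n)) (g (suc n))

  ∂-⊝ : ∀ f → ∂ (⊝ f) ≋ ⊝ ∂ f
  ∂-⊝ f = pointwise λ n → sym (neg-distribʳ-* (ℕ→ℚ (suc n)) (f (suc n)))

  ∂-one : ∂ one ≋ 0ₛ
  ∂-one = pointwise λ n → *-zeroʳ (ℕ→ℚ (suc n))

  ∂-scale : ∀ c f → ∂ (scale c f) ≋ scale c (∂ f)
  ∂-scale c f = pointwise λ n → ℚ-*.x∙yz≈y∙xz (ℕ→ℚ (suc n)) c (f (suc n))

  ∂-const-⊛ : ∀ c f → ∂ (const c ⊛ f) ≋ const c ⊛ ∂ f
  ∂-const-⊛ c f = ≋-trans (∂-cong (const-⊛ c f)) (≋-trans (∂-scale c f) (≋-sym (const-⊛ c (∂ f))))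

  sumℚ-zipWith : ∀ m (F : ℕ → ℚ → ℚ) (a : ℕ → ℕ) (b : ℕ → ℚ) →
    sumℚ (zipWith F (applyUpTo a m) (applyUpTo b m)) ≡ ∑[ j < m ] F (a j) (b j)
  sumℚ-zipWith zero    F a b = refl
  sumℚ-zipWith (suc m) F a b = cong (_+_ (F (a 0) (b 0))) (sumℚ-zipWith m F (λ j → a (suc j)) (λ j → b (suc j)))

  invRev-applyUpTo : ∀ g n → invRev g n ≡ applyUpTo (λ j → inv₁ g (n ∸ j)) (suc n)
  invRev-applyUpTo g zero    = refl
  invRev-applyUpTo g (suc n) = cong (inv₁ g (suc n) ∷_) (invRev-applyUpTo g n)

  inv₁-suc : ∀ g n → inv₁ g (suc n) ≡ - (∑[ j < suc n ] g (suc j) * inv₁ g (n ∸ j))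
  inv₁-suc g n = begin
    - sumℚ (zipWith step (upTo (suc n)) (invRev g n))
      ≡⟨ cong (λ bs → - sumℚ (zipWith step (upTo (suc n)) bs)) (invRev-applyUpTo g n) ⟩
    - sumℚ (zipWith step (upTo (suc n)) (applyUpTo (λ j → inv₁ g (n ∸ j)) (suc n)))
      ≡⟨ cong -_ (sumℚ-zipWith (suc n) step id (λ j → inv₁ g (n ∸ j))) ⟩
    - (∑[ j < suc n ] g (suc j) * inv₁ g (n ∸ j))
      ∎
    where
    open ≡-Reasoning
    step : ℕ → ℚ → ℚ
    step j b = g (suc j) * b

  ⊛-inverseʳ : ∀ g → g 0 ≡ 1ℚ → g ⊛ inv₁ g ≋ one
  ⊛-inverseʳ g g₀≡1 = pointwise coeff
    where
    open ≡-Reasoning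
    coeff : ∀ n → (g ⊛ inv₁ g) n ≡ one n
    coeff zero    = trans (+-identityʳ (g 0 * 1ℚ)) (trans (*-identityʳ (g 0)) g₀≡1)
    coeff (suc n) = begin
      (g ⊛ inv₁ g) (suc n)            ≡⟨ ⊛-coeff g (inv₁ g) (suc n) ⟩
      g 0 * inv₁ g (suc n) + tail     ≡⟨ cong (λ x → x * inv₁ g (suc n) + tail) g₀≡1 ⟩
      1ℚ * inv₁ g (suc n) + tail      ≡⟨ cong (_+ tail) (trans (*-identityˡ (inv₁ g (suc n))) (inv₁-suc g n)) ⟩
      - tail + tail                   ≡⟨ +-inverseˡ tail ⟩
      0ℚ                              ∎
      where tail = ∑[ j < suc n ] g (suc j) * inv₁ g (n ∸ j)

  ⊛-cancelˡ : ∀ h {u v} → h 0 ≡ 1ℚ → h ⊛ u ≋ h ⊛ v → u ≋ v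
  ⊛-cancelˡ h {u} {v} h₀≡1 hu≋hv = begin
    u                     ≈⟨ ≋-sym (⊛-identityˡ u) ⟩
    one ⊛ u               ≈⟨ ⊛-congʳ u (≋-sym h⊛h⁻¹) ⟩
    (h ⊛ h⁻¹) ⊛ u         ≈⟨ solve 3 (λ h i u → (h :* i) :* u := i :* (h :* u)) ≋-refl h h⁻¹ u ⟩
    h⁻¹ ⊛ (h ⊛ u)         ≈⟨ ⊛-congˡ h⁻¹ hu≋hv ⟩
    h⁻¹ ⊛ (h ⊛ v)         ≈⟨ solve 3 (λ h i v → i :* (h :* v) := (h :* i) :* v) ≋-refl h h⁻¹ v ⟩
    (h ⊛ h⁻¹) ⊛ v         ≈⟨ ⊛-congʳ v h⊛h⁻¹ ⟩
    one ⊛ v               ≈⟨ ⊛-identityˡ v ⟩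
    v                     ∎
    where
    open ≋-Reasoning
    open Series-Solver
    h⁻¹ = inv₁ h
    h⊛h⁻¹ = ⊛-inverseʳ h h₀≡1

  divT-⊛ : ∀ f g → f 0 ≡ 0ℚ → divT (f ⊛ g) ≋ divT f ⊛ g
  divT-⊛ f g f₀≡0 = pointwise λ n → begin
    (f ⊛ g) (suc n)                 ≡⟨ ⊛-coeff f g (suc n) ⟩
    f 0 * g (suc n) + tail n        ≡⟨ cong (λ x → x * g (suc n) + tail n) f₀≡0 ⟩
    0ℚ * g (suc n) + tail n         ≡⟨ cong (_+ tail n) (*-zeroˡ (g (suc n))) ⟩
    0ℚ + tail n                     ≡⟨ +-identityˡ (tail n) ⟩
    tail n                          ≡⟨ ⊛-coeff (divT f) g n ⟨
    (divT f ⊛ g) n                  ∎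
    where
    open ≡-Reasoning
    tail : ℕ → ℚ
    tail n = ∑[ i < suc n ] f (suc i) * g (n ∸ i)

  _^ℚ_ : ℚ → ℕ → ℚ
  r ^ℚ zero  = 1ℚ
  r ^ℚ suc n = r * r ^ℚ n

  ^ℚ-+ : ∀ r i j → r ^ℚ (i ℕ.+ j) ≡ r ^ℚ i * r ^ℚ j
  ^ℚ-+ r zero    j = sym (*-identityˡ (r ^ℚ j))
  ^ℚ-+ r (suc i) j = trans (cong (r *_) (^ℚ-+ r i j)) (sym (*-assoc r (r ^ℚ i) (r ^ℚ j)))

  -- rescale r f is f(r t).
  rescale : ℚ → Series → Series
  rescale r f n = r ^ℚ n * f n

  rescale-cong : ∀ r {f g} → f ≋ g → rescale r f ≋ rescale r g
  rescale-cong r f≋g = pointwise λ n → cong (r ^ℚ n *_) (at f≋g n)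

  rescale-⊕ : ∀ r f g → rescale r (f ⊕ g) ≋ rescale r f ⊕ rescale r g
  rescale-⊕ r f g = pointwise λ n → *-distribˡ-+ (r ^ℚ n) (f n) (g n)

  rescale-⊝ : ∀ r f → rescale r (⊝ f) ≋ ⊝ rescale r f
  rescale-⊝ r f = pointwise λ n → sym (neg-distribʳ-* (r ^ℚ n) (f n))

  rescale-one : ∀ r → rescale r one ≋ one
  rescale-one r = pointwise λ where
    zero    → refl
    (suc n) → *-zeroʳ (r ^ℚ suc n)

  rescale-const : ∀ r c → rescale r (const c) ≋ const c
  rescale-const r c = pointwise λ where
    zero    → *-identityˡ (c * 1ℚ)
    (suc n) → trans (cong (r ^ℚ suc n *_) (*-zeroʳ c)) (trans (*-zeroʳ (r ^ℚ suc n)) (sym (*-zeroʳ c)))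

  rescale-⊛ : ∀ r f g → rescale r (f ⊛ g) ≋ rescale r f ⊛ rescale r g
  rescale-⊛ r f g = pointwise λ n → begin
    r ^ℚ n * (f ⊛ g) n                                       ≡⟨ cong (r ^ℚ n *_) (⊛-coeff f g n) ⟩
    r ^ℚ n * (∑[ i < suc n ] f i * g (n ∸ i))                ≡⟨ ∑-*ˡ (suc n) (r ^ℚ n) (λ i → f i * g (n ∸ i)) ⟨
    ∑[ i < suc n ] r ^ℚ n * (f i * g (n ∸ i))                ≡⟨ ∑-cong-< (suc n) (split n) ⟩
    ∑[ i < suc n ] rescale r f i * rescale r g (n ∸ i)       ≡⟨ ⊛-coeff (rescale r f) (rescale r g) n ⟨
    (rescale r f ⊛ rescale r g) n                            ∎
    where
    open ≡-Reasoning
    split : ∀ n i → i ℕ.< suc n → r ^ℚ n * (f i * g (n ∸ i)) ≡ rescale r f i * rescale r g (n ∸ i)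
    split n i i<1+n = begin
      r ^ℚ n * (f i * g (n ∸ i))
        ≡⟨ cong (λ m → r ^ℚ m * (f i * g (n ∸ i))) (ℕ.m+[n∸m]≡n (ℕ.≤-pred i<1+n)) ⟨
      r ^ℚ (i ℕ.+ (n ∸ i)) * (f i * g (n ∸ i))
        ≡⟨ cong (_* (f i * g (n ∸ i))) (^ℚ-+ r i (n ∸ i)) ⟩
      r ^ℚ i * r ^ℚ (n ∸ i) * (f i * g (n ∸ i))
        ≡⟨ ℚ-*.interchange (r ^ℚ i) (r ^ℚ (n ∸ i)) (f i) (g (n ∸ i)) ⟩
      rescale r f i * rescale r g (n ∸ i)
        ∎

  ∂-rescale : ∀ r f → ∂ (rescale r f) ≋ const r ⊛ rescale r (∂ f)
  ∂-rescale r f = pointwise λ n →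
    trans (ℚ-Ring.solve 4 (λ x r p y → x :* ((r :* p) :* y) := r :* (p :* (x :* y))) refl (ℕ→ℚ (suc n)) r (r ^ℚ n) (f (suc n)))
          (sym (at (const-⊛ r (rescale r (∂ f))) n))
    where open ℚ-Ring

  ∂-system-unique : ∀ r {f g f′ g′} → f 0 ≡ f′ 0 → g 0 ≡ g′ 0 →
    ∂ f ≋ const r ⊛ g → ∂ g ≋ const r ⊛ f → ∂ f′ ≋ const r ⊛ g′ → ∂ g′ ≋ const r ⊛ f′ →
    f ≋ f′ × g ≋ g′
  ∂-system-unique r {f} {g} {f′} {g′} f₀ g₀ ∂f ∂g ∂f′ ∂g′ =
    pointwise (λ n → proj₁ (coeffs n)) , pointwise (λ n → proj₂ (coeffs n))
    where
    step : ∀ u v u′ v′ n → ∂ u ≋ const r ⊛ v → ∂ u′ ≋ const r ⊛ v′ → v n ≡ v′ n → u (suc n) ≡ u′ (suc n)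
    step u v u′ v′ n ∂u ∂u′ vₙ = ℕ→ℚ-*-cancelˡ n
      (trans (at (≋-trans ∂u (const-⊛ r v)) n) (trans (cong (r *_) vₙ) (sym (at (≋-trans ∂u′ (const-⊛ r v′)) n))))
    coeffs : ∀ n → f n ≡ f′ n × g n ≡ g′ n
    coeffs zero    = f₀ , g₀
    coeffs (suc n) = step f g f′ g′ n ∂f ∂f′ (proj₂ (coeffs n)) , step g f g′ f′ n ∂g ∂g′ (proj₁ (coeffs n))

  -- Exponential and hyperbolic series

  2ℚ : ℚ
  2ℚ = ℕ→ℚ 2

  ℕ→ℚ-*-1/ : ∀ a d .{{_ : ℕ.NonZero d}} →
    ℕ→ℚ (suc a) * (_/_ (+ 1) (suc a ℕ.* d) {{ℕ.m*n≢0 (suc a) d}}) ≡ + 1 / d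
  ℕ→ℚ-*-1/ a (suc d) = toℚᵘ-injective (ℚᵘ.≃-trans (toℚᵘ-homo-* (ℕ→ℚ (suc a)) (+ 1 / (suc a ℕ.* suc d)))
    (ℚᵘ.≃-trans (ℚᵘ.*-cong (toℚᵘ-ℤ→ℚ (+ suc a)) (toℚᵘ-fromℚᵘ (ℚᵘ.mkℚᵘ (+ 1) (d ℕ.+ a ℕ.* suc d))))
    (ℚᵘ.≃-trans (ℚᵘ.*≡* same) (ℚᵘ.≃-sym (toℚᵘ-fromℚᵘ (ℚᵘ.mkℚᵘ (+ 1) d))))))
    where
    open ℤ-Solver.+-*-Solver
    same : (+ suc a ℤ.* + 1) ℤ.* + suc d ≡ + 1 ℤ.* (+ 1 ℤ.* + (suc a ℕ.* suc d))
    same = trans (solve 2 (λ x y → (x :* con (+ 1)) :* y := con (+ 1) :* (con (+ 1) :* (x :* y))) refl (+ suc a) (+ suc d))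
                 (cong (λ z → + 1 ℤ.* (+ 1 ℤ.* z)) (sym (ℤ.pos-* (suc a) (suc d))))

  ∂-expS : ∂ expS ≋ expS
  ∂-expS = pointwise λ n → ℕ→ℚ-*-1/ n (n !) {{n ℕ.!≢0}}

  ∂-coshS : ∂ coshS ≋ sinhS
  ∂-coshS = pointwise λ n → trans
    (ℚ-Ring.solve 3 (λ x e σ → x :* (con ½ :* (e :+ :- σ :* e)) := con ½ :* (x :* e :+ :- (σ :* (x :* e))))
                    refl (ℕ→ℚ (suc n)) (expS (suc n)) (sgn n))
    (cong (λ e → ½ * (e - sgn n * e)) (at ∂-expS n))
    where open ℚ-Ring

  ∂-sinhS : ∂ sinhS ≋ coshS
  ∂-sinhS = pointwise λ n → trans
    (ℚ-Ring.solve 3 (λ x e σ → x :* (con ½ :* (e :+ :- (:- σ :* e))) := con ½ :* (x :* e :+ σ :* (x :* e)))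
                    refl (ℕ→ℚ (suc n)) (expS (suc n)) (sgn n))
    (cong (λ e → ½ * (e + sgn n * e)) (at ∂-expS n))
    where open ℚ-Ring

  -- (C, S) behaves like (cosh (r t), sinh (r t)).
  record IsHyperbolicPair (r : ℚ) (C S : Series) : Set where
    field
      C₀ : C 0 ≡ 1ℚ
      S₀ : S 0 ≡ 0ℚ
      ∂C : ∂ C ≋ const r ⊛ S
      ∂S : ∂ S ≋ const r ⊛ C

  module _ {r C S} (pair : IsHyperbolicPair r C S) where
    open IsHyperbolicPair pair

    hyperbolic-pair-unique : ∀ {C′ S′} → IsHyperbolicPair r C′ S′ → C ≋ C′ × S ≋ S′
    hyperbolic-pair-unique pair′ = ∂-system-unique r (trans C₀ (sym P.C₀)) (trans S₀ (sym P.S₀)) ∂C ∂S P.∂C P.∂S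
      where module P = IsHyperbolicPair pair′

    private
      k = const r

    ∂-C² : ∂ (C ⊛ C) ≋ const 2ℚ ⊛ (k ⊛ (C ⊛ S))
    ∂-C² = begin
      ∂ (C ⊛ C)
        ≈⟨ ∂-⊛ C C ⟩
      (∂ C ⊛ C) ⊕ (C ⊛ ∂ C)
        ≈⟨ ⊕-cong (⊛-congʳ C ∂C) (⊛-congˡ C ∂C) ⟩
      ((k ⊛ S) ⊛ C) ⊕ (C ⊛ (k ⊛ S))
        ≈⟨ solve 3 (λ k c s → (k :* s) :* c :+ c :* (k :* s) := con 2ℚ :* (k :* (c :* s))) ≋-refl k C S ⟩
      const 2ℚ ⊛ (k ⊛ (C ⊛ S))
        ∎
      where
      open ≋-Reasoning
      open Series-Solver

    ∂-S² : ∂ (S ⊛ S) ≋ const 2ℚ ⊛ (k ⊛ (C ⊛ S))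
    ∂-S² = begin
      ∂ (S ⊛ S)
        ≈⟨ ∂-⊛ S S ⟩
      (∂ S ⊛ S) ⊕ (S ⊛ ∂ S)
        ≈⟨ ⊕-cong (⊛-congʳ S ∂S) (⊛-congˡ S ∂S) ⟩
      ((k ⊛ C) ⊛ S) ⊕ (S ⊛ (k ⊛ C))
        ≈⟨ solve 3 (λ k c s → (k :* c) :* s :+ s :* (k :* c) := con 2ℚ :* (k :* (c :* s))) ≋-refl k C S ⟩
      const 2ℚ ⊛ (k ⊛ (C ⊛ S))
        ∎
      where
      open ≋-Reasoning
      open Series-Solver

    ∂-C⊛S : ∂ (C ⊛ S) ≋ k ⊛ ((C ⊛ C) ⊕ (S ⊛ S))
    ∂-C⊛S = begin
      ∂ (C ⊛ S)
        ≈⟨ ∂-⊛ C S ⟩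
      (∂ C ⊛ S) ⊕ (C ⊛ ∂ S)
        ≈⟨ ⊕-cong (⊛-congʳ S ∂C) (⊛-congˡ C ∂S) ⟩
      ((k ⊛ S) ⊛ S) ⊕ (C ⊛ (k ⊛ C))
        ≈⟨ solve 3 (λ k c s → (k :* s) :* s :+ c :* (k :* c) := k :* (c :* c :+ s :* s)) ≋-refl k C S ⟩
      k ⊛ ((C ⊛ C) ⊕ (S ⊛ S))
        ∎
      where
      open ≋-Reasoning
      open Series-Solver

    cosh²-sinh² : (C ⊛ C) ⊕ ⊝ (S ⊛ S) ≋ one
    cosh²-sinh² = ∂-injective initial (begin
      ∂ ((C ⊛ C) ⊕ ⊝ (S ⊛ S))      ≈⟨ ≋-trans (∂-⊕ (C ⊛ C) (⊝ (S ⊛ S))) (⊕-congˡ (∂ (C ⊛ C)) (∂-⊝ (S ⊛ S))) ⟩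
      ∂ (C ⊛ C) ⊕ ⊝ ∂ (S ⊛ S)       ≈⟨ ⊕-cong ∂-C² (⊝-cong ∂-S²) ⟩
      x ⊕ ⊝ x                       ≈⟨ solve 1 (λ x → x :+ :- x := con 0ℚ) ≋-refl x ⟩
      const 0ℚ                      ≈⟨ ≋-trans const-zero (≋-sym ∂-one) ⟩
      ∂ one                         ∎)
      where
      open ≋-Reasoning
      open Series-Solver
      x = const 2ℚ ⊛ (k ⊛ (C ⊛ S))
      initial : ((C ⊛ C) ⊕ ⊝ (S ⊛ S)) 0 ≡ 1ℚ
      initial rewrite C₀ | S₀ = refl

    double-angle : IsHyperbolicPair (2ℚ * r) ((C ⊛ C) ⊕ (S ⊛ S)) (const 2ℚ ⊛ (C ⊛ S))
    double-angle = record
      { C₀ = C₀′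
      ; S₀ = S₀′
      ; ∂C = begin
          ∂ ((C ⊛ C) ⊕ (S ⊛ S))
            ≈⟨ ≋-trans (∂-⊕ (C ⊛ C) (S ⊛ S)) (⊕-cong ∂-C² ∂-S²) ⟩
          x ⊕ x
            ≈⟨ solve 3 (λ k c s → con 2ℚ :* (k :* (c :* s)) :+ con 2ℚ :* (k :* (c :* s))
                               := (con 2ℚ :* k) :* (con 2ℚ :* (c :* s))) ≋-refl k C S ⟩
          (const 2ℚ ⊛ k) ⊛ (const 2ℚ ⊛ (C ⊛ S))
            ≈⟨ ⊛-congʳ (const 2ℚ ⊛ (C ⊛ S)) (≋-sym (const-* 2ℚ r)) ⟩
          const (2ℚ * r) ⊛ (const 2ℚ ⊛ (C ⊛ S))
            ∎
      ; ∂S = begin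
          ∂ (const 2ℚ ⊛ (C ⊛ S))
            ≈⟨ ≋-trans (∂-const-⊛ 2ℚ (C ⊛ S)) (⊛-congˡ (const 2ℚ) ∂-C⊛S) ⟩
          const 2ℚ ⊛ (k ⊛ ((C ⊛ C) ⊕ (S ⊛ S)))
            ≈⟨ solve 3 (λ k c s → con 2ℚ :* (k :* (c :* c :+ s :* s))
                               := (con 2ℚ :* k) :* (c :* c :+ s :* s)) ≋-refl k C S ⟩
          (const 2ℚ ⊛ k) ⊛ ((C ⊛ C) ⊕ (S ⊛ S))
            ≈⟨ ⊛-congʳ ((C ⊛ C) ⊕ (S ⊛ S)) (≋-sym (const-* 2ℚ r)) ⟩
          const (2ℚ * r) ⊛ ((C ⊛ C) ⊕ (S ⊛ S))
            ∎
      }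
      where
      open ≋-Reasoning
      open Series-Solver
      x = const 2ℚ ⊛ (k ⊛ (C ⊛ S))
      C₀′ : ((C ⊛ C) ⊕ (S ⊛ S)) 0 ≡ 1ℚ
      C₀′ rewrite C₀ | S₀ = refl
      S₀′ : (const 2ℚ ⊛ (C ⊛ S)) 0 ≡ 0ℚ
      S₀′ rewrite C₀ | S₀ = refl

    rescale-hyperbolic-pair : ∀ q → IsHyperbolicPair (q * r) (rescale q C) (rescale q S)
    rescale-hyperbolic-pair q = record
      { C₀ = trans (*-identityˡ (C 0)) C₀
      ; S₀ = trans (*-identityˡ (S 0)) S₀
      ; ∂C = rate C S ∂C
      ; ∂S = rate S C ∂S
      }
      where
      open ≋-Reasoning
      rate : ∀ F G → ∂ F ≋ const r ⊛ G → ∂ (rescale q F) ≋ const (q * r) ⊛ rescale q G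
      rate F G ∂F = begin
        ∂ (rescale q F)
          ≈⟨ ∂-rescale q F ⟩
        const q ⊛ rescale q (∂ F)
          ≈⟨ ⊛-congˡ (const q) (rescale-cong q ∂F) ⟩
        const q ⊛ rescale q (const r ⊛ G)
          ≈⟨ ⊛-congˡ (const q) (rescale-⊛ q (const r) G) ⟩
        const q ⊛ (rescale q (const r) ⊛ rescale q G)
          ≈⟨ ⊛-congˡ (const q) (⊛-congʳ (rescale q G) (rescale-const q r)) ⟩
        const q ⊛ (const r ⊛ rescale q G)
          ≈⟨ ≋-sym (⊛-assoc (const q) (const r) (rescale q G)) ⟩
        (const q ⊛ const r) ⊛ rescale q G
          ≈⟨ ⊛-congʳ (rescale q G) (≋-sym (const-* q r)) ⟩
        const (q * r) ⊛ rescale q G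
          ∎

  hyperbolic-pair-resp : ∀ {r C S C′ S′} → C ≋ C′ → S ≋ S′ → IsHyperbolicPair r C S → IsHyperbolicPair r C′ S′
  hyperbolic-pair-resp {r} C≋C′ S≋S′ pair = record
    { C₀ = trans (sym (at C≋C′ 0)) C₀
    ; S₀ = trans (sym (at S≋S′ 0)) S₀
    ; ∂C = ≋-trans (∂-cong (≋-sym C≋C′)) (≋-trans ∂C (⊛-congˡ (const r) S≋S′))
    ; ∂S = ≋-trans (∂-cong (≋-sym S≋S′)) (≋-trans ∂S (⊛-congˡ (const r) C≋C′))
    }
    where open IsHyperbolicPair pair

  const-1-⊛ : ∀ f → const 1ℚ ⊛ f ≋ f
  const-1-⊛ f = ≋-trans (const-⊛ 1ℚ f) (pointwise λ n → *-identityˡ (f n))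

  cosh-sinh : IsHyperbolicPair 1ℚ coshS sinhS
  cosh-sinh = record
    { C₀ = refl
    ; S₀ = refl
    ; ∂C = ≋-trans ∂-coshS (≋-sym (const-1-⊛ sinhS))
    ; ∂S = ≋-trans ∂-sinhS (≋-sym (const-1-⊛ coshS))
    }

  halfArg-rescale : ∀ f → halfArg f ≋ rescale ½ f
  halfArg-rescale f = pointwise λ n → cong (_* f n) (half^-^ℚ n)
    where
    half^-^ℚ : ∀ n → half^ n ≡ ½ ^ℚ n
    half^-^ℚ zero    = refl
    half^-^ℚ (suc n) = cong (½ *_) (half^-^ℚ n)

  coshHalf sinhHalf : Series
  coshHalf = halfArg coshS
  sinhHalf = halfArg sinhS

  coshHalf-sinhHalf : IsHyperbolicPair ½ coshHalf sinhHalf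
  coshHalf-sinhHalf = hyperbolic-pair-resp (≋-sym (halfArg-rescale coshS)) (≋-sym (halfArg-rescale sinhS))
    (rescale-hyperbolic-pair cosh-sinh ½)

  cosh-double : (coshS ⊛ coshS) ⊕ (sinhS ⊛ sinhS) ≋ rescale 2ℚ coshS
  cosh-double = proj₁ (hyperbolic-pair-unique (double-angle cosh-sinh) (rescale-hyperbolic-pair cosh-sinh 2ℚ))

  sinh-double : const 2ℚ ⊛ (coshS ⊛ sinhS) ≋ rescale 2ℚ sinhS
  sinh-double = proj₂ (hyperbolic-pair-unique (double-angle cosh-sinh) (rescale-hyperbolic-pair cosh-sinh 2ℚ))

  sinh-half-double : const 2ℚ ⊛ (coshHalf ⊛ sinhHalf) ≋ sinhS
  sinh-half-double = proj₂ (hyperbolic-pair-unique (double-angle coshHalf-sinhHalf) cosh-sinh)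

  coshHalf-⊛-tanhHalf : coshHalf ⊛ tanhHalf ≋ sinhHalf
  coshHalf-⊛-tanhHalf = begin
    c ⊛ (s ⊛ inv₁ c)   ≈⟨ solve 3 (λ c s i → c :* (s :* i) := s :* (c :* i)) ≋-refl c s (inv₁ c) ⟩
    s ⊛ (c ⊛ inv₁ c)   ≈⟨ ⊛-congˡ s (⊛-inverseʳ c refl) ⟩
    s ⊛ one            ≈⟨ ⊛-identityʳ s ⟩
    s                  ∎
    where
    open ≋-Reasoning
    open Series-Solver
    c = coshHalf
    s = sinhHalf

  ∂-tanhHalf : ∂ tanhHalf ≋ const ½ ⊛ (const 1ℚ ⊕ ⊝ (tanhHalf ⊛ tanhHalf))
  ∂-tanhHalf = ⊛-cancelˡ c refl (begin
    c ⊛ ∂ T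
      ≈⟨ solve 4 (λ c c′ t t′ → c :* t′ := (c′ :* t :+ c :* t′) :+ :- (c′ :* t)) ≋-refl c (∂ c) T (∂ T) ⟩
    ((∂ c ⊛ T) ⊕ (c ⊛ ∂ T)) ⊕ ⊝ (∂ c ⊛ T)
      ≈⟨ ⊕-congʳ (⊝ (∂ c ⊛ T)) (≋-sym (∂-⊛ c T)) ⟩
    ∂ (c ⊛ T) ⊕ ⊝ (∂ c ⊛ T)
      ≈⟨ ⊕-cong (≋-trans (∂-cong coshHalf-⊛-tanhHalf) ∂S) (⊝-cong (⊛-congʳ T ∂C)) ⟩
    (const ½ ⊛ c) ⊕ ⊝ ((const ½ ⊛ s) ⊛ T)
      ≈⟨ ⊕-congˡ (const ½ ⊛ c) (⊝-cong (⊛-congʳ T (⊛-congˡ (const ½) (≋-sym coshHalf-⊛-tanhHalf)))) ⟩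
    (const ½ ⊛ c) ⊕ ⊝ ((const ½ ⊛ (c ⊛ T)) ⊛ T)
      ≈⟨ solve 2 (λ c t → con ½ :* c :+ :- ((con ½ :* (c :* t)) :* t) := c :* (con ½ :* (con 1ℚ :+ :- (t :* t)))) ≋-refl c T ⟩
    c ⊛ (const ½ ⊛ (const 1ℚ ⊕ ⊝ (T ⊛ T)))
      ∎)
    where
    open ≋-Reasoning
    open Series-Solver
    open IsHyperbolicPair coshHalf-sinhHalf using (∂C; ∂S)
    c = coshHalf
    s = sinhHalf
    T = tanhHalf

  sinh-⊛-∂-tanhHalf : sinhS ⊛ ∂ tanhHalf ≋ tanhHalf
  sinh-⊛-∂-tanhHalf = ⊛-cancelˡ c refl (begin
    c ⊛ (sinhS ⊛ ∂ T)
      ≈⟨ ⊛-congˡ c (⊛-cong (≋-sym sinh-half-double) ∂-tanhHalf) ⟩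
    c ⊛ ((const 2ℚ ⊛ (c ⊛ s)) ⊛ (const ½ ⊛ (const 1ℚ ⊕ ⊝ (T ⊛ T))))
      ≈⟨ solve 3 (λ c s t → c :* ((con 2ℚ :* (c :* s)) :* (con ½ :* (con 1ℚ :+ :- (t :* t))))
                         := s :* (c :* c :+ :- ((c :* t) :* (c :* t)))) ≋-refl c s T ⟩
    s ⊛ ((c ⊛ c) ⊕ ⊝ ((c ⊛ T) ⊛ (c ⊛ T)))
      ≈⟨ ⊛-congˡ s (⊕-congˡ (c ⊛ c) (⊝-cong (⊛-cong coshHalf-⊛-tanhHalf coshHalf-⊛-tanhHalf))) ⟩
    s ⊛ ((c ⊛ c) ⊕ ⊝ (s ⊛ s))
      ≈⟨ ⊛-congˡ s (cosh²-sinh² coshHalf-sinhHalf) ⟩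
    s ⊛ one
      ≈⟨ ⊛-identityʳ s ⟩
    s
      ≈⟨ coshHalf-⊛-tanhHalf ⟨
    c ⊛ T
      ∎)
    where
    open ≋-Reasoning
    open Series-Solver
    c = coshHalf
    s = sinhHalf
    T = tanhHalf

  -- Composition of series

  -- shift a is z · a(z).
  shift : Series → Series
  shift a zero    = 0ℚ
  shift a (suc m) = a m

  ∑-*-⊛ : ∀ N n (a : ℕ → ℚ) (W : ℕ → Series) (V : Series) →
    ∑[ m < N ] a m * (W m ⊛ V) n ≡ ∑[ i < suc n ] (∑[ m < N ] a m * W m i) * V (n ∸ i)
  ∑-*-⊛ N n a W V = begin
    ∑[ m < N ] a m * (W m ⊛ V) n
      ≡⟨ ∑-cong N (λ m → cong (a m *_) (⊛-coeff (W m) V n)) ⟩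
    ∑[ m < N ] a m * (∑[ i < suc n ] W m i * V (n ∸ i))
      ≡⟨ ∑-cong N (λ m → ∑-*ˡ (suc n) (a m) (λ i → W m i * V (n ∸ i))) ⟨
    ∑[ m < N ] ∑[ i < suc n ] a m * (W m i * V (n ∸ i))
      ≡⟨ ∑-comm N (suc n) (λ m i → a m * (W m i * V (n ∸ i))) ⟩
    ∑[ i < suc n ] ∑[ m < N ] a m * (W m i * V (n ∸ i))
      ≡⟨ ∑-cong (suc n) (λ i → ∑-cong N (λ m → *-assoc (a m) (W m i) (V (n ∸ i)))) ⟨
    ∑[ i < suc n ] ∑[ m < N ] a m * W m i * V (n ∸ i)
      ≡⟨ ∑-cong (suc n) (λ i → ∑-*ʳ N (V (n ∸ i)) (λ m → a m * W m i)) ⟩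
    ∑[ i < suc n ] (∑[ m < N ] a m * W m i) * V (n ∸ i)
      ∎
    where open ≡-Reasoning

  module _ (U : Series) (U₀ : U 0 ≡ 0ℚ) where

    pow-vanishes : ∀ m n → n ℕ.< m → pow U m n ≡ 0ℚ
    pow-vanishes (suc m) n n<1+m = trans (⊛-coeff U (pow U m) n) (∑-zero (suc n) (term n n<1+m))
      where
      term : ∀ n → n ℕ.< suc m → ∀ i → i ℕ.< suc n → U i * pow U m (n ∸ i) ≡ 0ℚ
      term n _ zero _ = trans (cong (_* pow U m n) U₀) (*-zeroˡ (pow U m n))
      term (suc n) n<m (suc i) (ℕ.s≤s i≤n) =
        trans (cong (U (suc i) *_) (pow-vanishes m (n ∸ i) (ℕ.≤-<-trans (ℕ.m∸n≤m n i) (ℕ.≤-pred n<m))))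
              (*-zeroʳ (U (suc i)))

    compose-coeff : ∀ a n → compose a U n ≡ ∑[ m < suc n ] a m * pow U m n
    compose-coeff a n = Σ≤-∑ n (λ m → a m * pow U m n)

    compose-coeff-extend : ∀ a n N → n ℕ.< N → compose a U n ≡ ∑[ m < N ] a m * pow U m n
    compose-coeff-extend a n N n<N = trans (compose-coeff a n) (sym (∑-extend (suc n) N (λ m → a m * pow U m n) n<N
      (λ m n<m → trans (cong (a m *_) (pow-vanishes m n n<m)) (*-zeroʳ (a m)))))

    compose-cong : ∀ {a b} → a ≋ b → compose a U ≋ compose b U
    compose-cong {a} {b} a≋b = pointwise λ n → trans (compose-coeff a n)
      (trans (∑-cong (suc n) (λ m → cong (_* pow U m n) (at a≋b m))) (sym (compose-coeff b n)))

    compose-⊕ : ∀ a b → compose (a ⊕ b) U ≋ compose a U ⊕ compose b U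
    compose-⊕ a b = pointwise λ n → begin
      compose (a ⊕ b) U n
        ≡⟨ compose-coeff (a ⊕ b) n ⟩
      ∑[ m < suc n ] (a m + b m) * pow U m n
        ≡⟨ ∑-cong (suc n) (λ m → *-distribʳ-+ (pow U m n) (a m) (b m)) ⟩
      ∑[ m < suc n ] (a m * pow U m n + b m * pow U m n)
        ≡⟨ ∑-+ (suc n) (λ m → a m * pow U m n) (λ m → b m * pow U m n) ⟩
      ∑[ m < suc n ] a m * pow U m n + ∑[ m < suc n ] b m * pow U m n
        ≡⟨ cong₂ _+_ (compose-coeff a n) (compose-coeff b n) ⟨
      compose a U n + compose b U n
        ∎
      where open ≡-Reasoning

    compose-const : ∀ c → compose (const c) U ≋ const c
    compose-const c = pointwise λ n → begin
      compose (const c) U n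
        ≡⟨ compose-coeff (const c) n ⟩
      c * 1ℚ * one n + ∑[ m < n ] c * 0ℚ * pow U (suc m) n
        ≡⟨ cong (_+_ (c * 1ℚ * one n)) (∑-zero n (λ m _ → trans (cong (_* pow U (suc m) n) (*-zeroʳ c)) (*-zeroˡ (pow U (suc m) n)))) ⟩
      c * 1ℚ * one n + 0ℚ
        ≡⟨ +-identityʳ (c * 1ℚ * one n) ⟩
      c * 1ℚ * one n
        ≡⟨ cong (_* one n) (*-identityʳ c) ⟩
      const c n
        ∎
      where open ≡-Reasoning

    compose-shift : ∀ a → compose (shift a) U ≋ compose a U ⊛ U
    compose-shift a = pointwise λ n → begin
      compose (shift a) U n
        ≡⟨ compose-coeff (shift a) n ⟩
      0ℚ * one n + ∑[ m < n ] a m * pow U (suc m) n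
        ≡⟨ cong (_+ ∑[ m < n ] a m * pow U (suc m) n) (*-zeroˡ (one n)) ⟩
      0ℚ + ∑[ m < n ] a m * pow U (suc m) n
        ≡⟨ +-identityˡ (∑[ m < n ] a m * pow U (suc m) n) ⟩
      ∑[ m < n ] a m * pow U (suc m) n
        ≡⟨ ∑-extend n (suc n) (λ m → a m * pow U (suc m) n) (ℕ.n≤1+n n)
             (λ m n≤m → trans (cong (a m *_) (pow-vanishes (suc m) n (ℕ.s≤s n≤m))) (*-zeroʳ (a m))) ⟨
      ∑[ m < suc n ] a m * (U ⊛ pow U m) n
        ≡⟨ ∑-cong (suc n) (λ m → cong (a m *_) (at (⊛-comm U (pow U m)) n)) ⟩
      ∑[ m < suc n ] a m * (pow U m ⊛ U) n
        ≡⟨ ∑-*-⊛ (suc n) n a (pow U) U ⟩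
      ∑[ i < suc n ] (∑[ m < suc n ] a m * pow U m i) * U (n ∸ i)
        ≡⟨ ∑-cong-< (suc n) (λ i i<1+n → cong (_* U (n ∸ i)) (compose-coeff-extend a i (suc n) i<1+n)) ⟨
      ∑[ i < suc n ] compose a U i * U (n ∸ i)
        ≡⟨ ⊛-coeff (compose a U) U n ⟨
      (compose a U ⊛ U) n
        ∎
      where open ≡-Reasoning

    ∂-pow : ∀ m → ∂ (pow U (suc m)) ≋ const (ℕ→ℚ (suc m)) ⊛ (pow U m ⊛ ∂ U)
    ∂-pow zero = begin
      ∂ (U ⊛ one)
        ≈⟨ ∂-⊛ U one ⟩
      (∂ U ⊛ one) ⊕ (U ⊛ ∂ one)
        ≈⟨ ⊕-congˡ (∂ U ⊛ one) (⊛-congˡ U (≋-trans ∂-one (≋-sym const-zero))) ⟩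
      (∂ U ⊛ one) ⊕ (U ⊛ const 0ℚ)
        ≈⟨ solve 3 (λ u′ u o → u′ :* o :+ u :* con 0ℚ := con 1ℚ :* (o :* u′)) ≋-refl (∂ U) U one ⟩
      const 1ℚ ⊛ (one ⊛ ∂ U)
        ∎
      where
      open ≋-Reasoning
      open Series-Solver
    ∂-pow (suc m) = begin
      ∂ (U ⊛ P (suc m))
        ≈⟨ ∂-⊛ U (P (suc m)) ⟩
      (∂ U ⊛ P (suc m)) ⊕ (U ⊛ ∂ (P (suc m)))
        ≈⟨ ⊕-congˡ (∂ U ⊛ P (suc m)) (⊛-congˡ U (∂-pow m)) ⟩
      (∂ U ⊛ (U ⊛ P m)) ⊕ (U ⊛ (k ⊛ (P m ⊛ ∂ U)))
        ≈⟨ solve 4 (λ u′ u p k → u′ :* (u :* p) :+ u :* (k :* (p :* u′)) := (k :+ con 1ℚ) :* ((u :* p) :* u′))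
                    ≋-refl (∂ U) U (P m) k ⟩
      (k ⊕ const 1ℚ) ⊛ (P (suc m) ⊛ ∂ U)
        ≈⟨ ⊛-congʳ (P (suc m) ⊛ ∂ U) (≋-sym (const-+ (ℕ→ℚ (suc m)) 1ℚ)) ⟩
      const (ℕ→ℚ (suc m) + 1ℚ) ⊛ (P (suc m) ⊛ ∂ U)
        ≈⟨ ⊛-congʳ (P (suc m) ⊛ ∂ U) (≋-reflexive (cong const (sym (ℕ→ℚ-suc (suc m))))) ⟩
      const (ℕ→ℚ (suc (suc m))) ⊛ (P (suc m) ⊛ ∂ U)
        ∎
      where
      open ≋-Reasoning
      open Series-Solver
      P = pow U
      k = const (ℕ→ℚ (suc m))

    chain-rule : ∀ a → ∂ (compose a U) ≋ compose (∂ a) U ⊛ ∂ U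
    chain-rule a = pointwise λ n → begin
      ℕ→ℚ (suc n) * compose a U (suc n)
        ≡⟨ cong (ℕ→ℚ (suc n) *_) (compose-coeff a (suc n)) ⟩
      ℕ→ℚ (suc n) * (∑[ m < suc (suc n) ] a m * pow U m (suc n))
        ≡⟨ ∑-*ˡ (suc (suc n)) (ℕ→ℚ (suc n)) (λ m → a m * pow U m (suc n)) ⟨
      ∑[ m < suc (suc n) ] ℕ→ℚ (suc n) * (a m * pow U m (suc n))
        ≡⟨ ∑-cong (suc (suc n)) (λ m → ℚ-*.x∙yz≈y∙xz (ℕ→ℚ (suc n)) (a m) (pow U m (suc n))) ⟩
      a 0 * ∂ one n + ∑[ m < suc n ] a (suc m) * ∂ (pow U (suc m)) n
        ≡⟨ cong₂ _+_ (trans (cong (a 0 *_) (at ∂-one n)) (*-zeroʳ (a 0)))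
                     (∑-cong (suc n) (λ m → cong (a (suc m) *_) (at (≋-trans (∂-pow m) (const-⊛ (ℕ→ℚ (suc m)) (pow U m ⊛ ∂ U))) n))) ⟩
      0ℚ + ∑[ m < suc n ] a (suc m) * (ℕ→ℚ (suc m) * (pow U m ⊛ ∂ U) n)
        ≡⟨ +-identityˡ (∑[ m < suc n ] a (suc m) * (ℕ→ℚ (suc m) * (pow U m ⊛ ∂ U) n)) ⟩
      ∑[ m < suc n ] a (suc m) * (ℕ→ℚ (suc m) * (pow U m ⊛ ∂ U) n)
        ≡⟨ ∑-cong (suc n) (λ m → ℚ-*.x∙yz≈yx∙z (a (suc m)) (ℕ→ℚ (suc m)) ((pow U m ⊛ ∂ U) n)) ⟩
      ∑[ m < suc n ] ∂ a m * (pow U m ⊛ ∂ U) n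
        ≡⟨ ∑-*-⊛ (suc n) n (∂ a) (pow U) (∂ U) ⟩
      ∑[ i < suc n ] (∑[ m < suc n ] ∂ a m * pow U m i) * ∂ U (n ∸ i)
        ≡⟨ ∑-cong-< (suc n) (λ i i<1+n → cong (_* ∂ U (n ∸ i)) (compose-coeff-extend (∂ a) i (suc n) i<1+n)) ⟨
      ∑[ i < suc n ] compose (∂ a) U i * ∂ U (n ∸ i)
        ≡⟨ ⊛-coeff (compose (∂ a) U) (∂ U) n ⟨
      (compose (∂ a) U ⊛ ∂ U) n
        ∎
      where open ≡-Reasoning

  -- The series A_{-m}(tanh(t/2)) and D_n^{(-m)}

  Li-neg : ∀ m j → Li (ℤ.- + m) (suc j) ≡ ℕ→ℚ (suc j ℕ.^ m)
  Li-neg zero    j = refl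
  Li-neg (suc m) j = refl

  A-neg-suc : ∀ m → A (ℤ.- + suc m) ≋ shift (∂ (A (ℤ.- + m)))
  A-neg-suc m = pointwise coeff
    where
    open ≡-Reasoning
    open ℚ-Ring using (solve; _:+_; _:*_; :-_; _:=_)
    coeff : ∀ j → A (ℤ.- + suc m) j ≡ shift (∂ (A (ℤ.- + m))) j
    coeff zero    = refl
    coeff (suc j) = begin
      Li (ℤ.- + suc m) (suc j) - σ * Li (ℤ.- + suc m) (suc j)
        ≡⟨ cong (λ l → l - σ * l) (trans (Li-neg (suc m) j) (ℕ→ℚ-* (suc j) (suc j ℕ.^ m))) ⟩
      x * ℕ→ℚ (suc j ℕ.^ m) - σ * (x * ℕ→ℚ (suc j ℕ.^ m))
        ≡⟨ solve 3 (λ x l σ → x :* l :+ :- (σ :* (x :* l)) := x :* (l :+ :- (σ :* l))) refl x (ℕ→ℚ (suc j ℕ.^ m)) σ ⟩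
      x * (ℕ→ℚ (suc j ℕ.^ m) - σ * ℕ→ℚ (suc j ℕ.^ m))
        ≡⟨ cong (λ l → x * (l - σ * l)) (Li-neg m j) ⟨
      x * (Li (ℤ.- + m) (suc j) - σ * Li (ℤ.- + m) (suc j))
        ∎
      where
      x = ℕ→ℚ (suc j)
      σ = sgn (suc j)

  -- A_0(z) = 2z / (1 − z²), in the form A_0(z) = z² A_0(z) + 2z.
  A-zero : A (+ 0) ≋ shift (shift (A (+ 0))) ⊕ shift (const 2ℚ)
  A-zero = pointwise coeff
    where
    open ℚ-Ring
    coeff : ∀ j → A (+ 0) j ≡ (shift (shift (A (+ 0))) ⊕ shift (const 2ℚ)) j
    coeff zero                = refl
    coeff (suc zero)          = refl
    coeff (suc (suc zero))    = refl
    coeff (suc (suc (suc j))) = solve 1 (λ σ → con 1ℚ :+ :- ((:- (:- (:- σ))) :* con 1ℚ)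
                                            := (con 1ℚ :+ :- ((:- σ) :* con 1ℚ)) :+ con 2ℚ :* con 0ℚ) refl (sgn j)

  F : ℕ → Series
  F m = compose (A (ℤ.- + m)) tanhHalf

  F-suc : ∀ m → F (suc m) ≋ sinhS ⊛ ∂ (F m)
  F-suc m = begin
    compose (A (ℤ.- + suc m)) T
      ≈⟨ compose-cong T refl (A-neg-suc m) ⟩
    compose (shift (∂ a)) T
      ≈⟨ compose-shift T refl (∂ a) ⟩
    compose (∂ a) T ⊛ T
      ≈⟨ ⊛-congˡ (compose (∂ a) T) (≋-sym sinh-⊛-∂-tanhHalf) ⟩
    compose (∂ a) T ⊛ (sinhS ⊛ ∂ T)
      ≈⟨ solve 3 (λ c s t′ → c :* (s :* t′) := s :* (c :* t′)) ≋-refl (compose (∂ a) T) sinhS (∂ T) ⟩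
    sinhS ⊛ (compose (∂ a) T ⊛ ∂ T)
      ≈⟨ ⊛-congˡ sinhS (chain-rule T refl a) ⟨
    sinhS ⊛ ∂ (F m)
      ∎
    where
    open ≋-Reasoning
    open Series-Solver
    T = tanhHalf
    a = A (ℤ.- + m)

  F-zero : F 0 ≋ sinhS
  F-zero = ⊛-cancelˡ W refl (begin
    W ⊛ F 0
      ≈⟨ solve 2 (λ t f → (con 1ℚ :+ :- (t :* t)) :* f := f :+ :- (t :* (t :* f))) ≋-refl T (F 0) ⟩
    F 0 ⊕ ⊝ (T ⊛ (T ⊛ F 0))
      ≈⟨ ⊕-congʳ (⊝ (T ⊛ (T ⊛ F 0))) fixed-point ⟩
    ((T ⊛ (T ⊛ F 0)) ⊕ (const 2ℚ ⊛ T)) ⊕ ⊝ (T ⊛ (T ⊛ F 0))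
      ≈⟨ solve 2 (λ t f → (t :* (t :* f) :+ con 2ℚ :* t) :+ :- (t :* (t :* f)) := con 2ℚ :* t) ≋-refl T (F 0) ⟩
    const 2ℚ ⊛ T
      ≈⟨ ⊛-congˡ (const 2ℚ) (≋-sym sinh-⊛-∂-tanhHalf) ⟩
    const 2ℚ ⊛ (sinhS ⊛ ∂ T)
      ≈⟨ ⊛-congˡ (const 2ℚ) (⊛-congˡ sinhS ∂-tanhHalf) ⟩
    const 2ℚ ⊛ (sinhS ⊛ (const ½ ⊛ W))
      ≈⟨ solve 2 (λ s w → con 2ℚ :* (s :* (con ½ :* w)) := w :* s) ≋-refl sinhS W ⟩
    W ⊛ sinhS
      ∎)
    where
    open ≋-Reasoning
    open Series-Solver
    T = tanhHalf
    W = const 1ℚ ⊕ ⊝ (T ⊛ T)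
    fixed-point : F 0 ≋ (T ⊛ (T ⊛ F 0)) ⊕ (const 2ℚ ⊛ T)
    fixed-point = begin
      compose (A (+ 0)) T
        ≈⟨ compose-cong T refl A-zero ⟩
      compose (shift (shift (A (+ 0))) ⊕ shift (const 2ℚ)) T
        ≈⟨ compose-⊕ T refl (shift (shift (A (+ 0)))) (shift (const 2ℚ)) ⟩
      compose (shift (shift (A (+ 0)))) T ⊕ compose (shift (const 2ℚ)) T
        ≈⟨ ⊕-cong (≋-trans (compose-shift T refl (shift (A (+ 0)))) (⊛-congʳ T (compose-shift T refl (A (+ 0)))))
                  (≋-trans (compose-shift T refl (const 2ℚ)) (⊛-congʳ T (compose-const T refl 2ℚ))) ⟩
      ((F 0 ⊛ T) ⊛ T) ⊕ (const 2ℚ ⊛ T)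
        ≈⟨ ⊕-congʳ (const 2ℚ ⊛ T) (solve 2 (λ f t → (f :* t) :* t := t :* (t :* f)) ≋-refl (F 0) T) ⟩
      (T ⊛ (T ⊛ F 0)) ⊕ (const 2ℚ ⊛ T)
        ∎

  -- D-series m has the coefficients D_n^{(-m)} / n!.
  D-series : ℕ → Series
  D-series zero    = one
  D-series (suc m) = (coshS ⊛ D-series m) ⊕ (sinhS ⊛ ∂ (D-series m))

  F≋sinh⊛D-series : ∀ m → F m ≋ sinhS ⊛ D-series m
  F≋sinh⊛D-series zero    = ≋-trans F-zero (≋-sym (⊛-identityʳ sinhS))
  F≋sinh⊛D-series (suc m) = begin
    F (suc m)                                         ≈⟨ F-suc m ⟩
    sinhS ⊛ ∂ (F m)                                   ≈⟨ ⊛-congˡ sinhS (∂-cong (F≋sinh⊛D-series m)) ⟩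
    sinhS ⊛ ∂ (sinhS ⊛ P)                             ≈⟨ ⊛-congˡ sinhS (∂-⊛ sinhS P) ⟩
    sinhS ⊛ ((∂ sinhS ⊛ P) ⊕ (sinhS ⊛ ∂ P))           ≈⟨ ⊛-congˡ sinhS (⊕-congʳ (sinhS ⊛ ∂ P) (⊛-congʳ P ∂-sinhS)) ⟩
    sinhS ⊛ D-series (suc m)                          ∎
    where
    open ≋-Reasoning
    P = D-series m

  D≡D-series : ∀ n m → D n (ℤ.- + m) ≡ ℕ→ℚ (n !) * D-series m n
  D≡D-series n m = cong (ℕ→ℚ (n !) *_) (at quotient n)
    where
    open ≋-Reasoning
    open Series-Solver
    s′ = divT sinhS
    P = D-series m
    quotient : divT (F m) ⊛ inv₁ s′ ≋ P
    quotient = begin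
      divT (F m) ⊛ inv₁ s′             ≈⟨ ⊛-congʳ (inv₁ s′) (pointwise λ n → at (F≋sinh⊛D-series m) (suc n)) ⟩
      divT (sinhS ⊛ P) ⊛ inv₁ s′       ≈⟨ ⊛-congʳ (inv₁ s′) (divT-⊛ sinhS P refl) ⟩
      (s′ ⊛ P) ⊛ inv₁ s′               ≈⟨ solve 3 (λ d p i → (d :* p) :* i := p :* (d :* i)) ≋-refl s′ P (inv₁ s′) ⟩
      P ⊛ (s′ ⊛ inv₁ s′)               ≈⟨ ⊛-congˡ P (⊛-inverseʳ s′ refl) ⟩
      P ⊛ one                          ≈⟨ ⊛-identityʳ P ⟩
      P                                ∎

  3ℚ : ℚ
  3ℚ = ℕ→ℚ 3

  -- D-series (2 k) (t) = Q k (2 t): apply the recursion of D-series twice and substitute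
  -- cosh² t + sinh² t = cosh 2t, 2 cosh t sinh t = sinh 2t and 2 sinh² t = cosh 2t − 1.
  Q : ℕ → Series
  Q zero    = one
  Q (suc k) = (coshS ⊛ Q k) ⊕ ((const 3ℚ ⊛ (sinhS ⊛ ∂ (Q k))) ⊕ (const 2ℚ ⊛ ((coshS ⊕ ⊝ one) ⊛ ∂ (∂ (Q k)))))

  D-series-suc-suc : ∀ m → D-series (suc (suc m)) ≋
    (((coshS ⊛ coshS) ⊕ (sinhS ⊛ sinhS)) ⊛ D-series m)
    ⊕ ((const 3ℚ ⊛ ((coshS ⊛ sinhS) ⊛ ∂ (D-series m))) ⊕ ((sinhS ⊛ sinhS) ⊛ ∂ (∂ (D-series m))))
  D-series-suc-suc m = begin
    (c ⊛ D-series (suc m)) ⊕ (s ⊛ ∂ (D-series (suc m)))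
      ≈⟨ ⊕-congˡ (c ⊛ D-series (suc m)) (⊛-congˡ s ∂-D-series-suc) ⟩
    (c ⊛ D-series (suc m)) ⊕ (s ⊛ (((s ⊛ p) ⊕ (c ⊛ ∂ p)) ⊕ ((c ⊛ ∂ p) ⊕ (s ⊛ ∂ (∂ p)))))
      ≈⟨ solve 5 (λ c s p p′ p″ → c :* (c :* p :+ s :* p′) :+ s :* ((s :* p :+ c :* p′) :+ (c :* p′ :+ s :* p″))
                               := (c :* c :+ s :* s) :* p :+ (con 3ℚ :* ((c :* s) :* p′) :+ (s :* s) :* p″)) ≋-refl c s p (∂ p) (∂ (∂ p)) ⟩
    (((c ⊛ c) ⊕ (s ⊛ s)) ⊛ p) ⊕ ((const 3ℚ ⊛ ((c ⊛ s) ⊛ ∂ p)) ⊕ ((s ⊛ s) ⊛ ∂ (∂ p)))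
      ∎
    where
    open ≋-Reasoning
    open Series-Solver
    c = coshS
    s = sinhS
    p = D-series m
    ∂-D-series-suc : ∂ (D-series (suc m)) ≋ ((s ⊛ p) ⊕ (c ⊛ ∂ p)) ⊕ ((c ⊛ ∂ p) ⊕ (s ⊛ ∂ (∂ p)))
    ∂-D-series-suc = begin
      ∂ ((c ⊛ p) ⊕ (s ⊛ ∂ p))
        ≈⟨ ∂-⊕ (c ⊛ p) (s ⊛ ∂ p) ⟩
      ∂ (c ⊛ p) ⊕ ∂ (s ⊛ ∂ p)
        ≈⟨ ⊕-cong (∂-⊛ c p) (∂-⊛ s (∂ p)) ⟩
      ((∂ c ⊛ p) ⊕ (c ⊛ ∂ p)) ⊕ ((∂ s ⊛ ∂ p) ⊕ (s ⊛ ∂ (∂ p)))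
        ≈⟨ ⊕-cong (⊕-congʳ (c ⊛ ∂ p) (⊛-congʳ p ∂-coshS))
                  (⊕-congʳ (s ⊛ ∂ (∂ p)) (⊛-congʳ (∂ p) ∂-sinhS)) ⟩
      ((s ⊛ p) ⊕ (c ⊛ ∂ p)) ⊕ ((c ⊛ ∂ p) ⊕ (s ⊛ ∂ (∂ p)))
        ∎

  private
    C₂ S₂ : Series
    C₂ = rescale 2ℚ coshS
    S₂ = rescale 2ℚ sinhS

  cosh⊛sinh : coshS ⊛ sinhS ≋ const ½ ⊛ S₂
  cosh⊛sinh = ≋-trans (solve 2 (λ c s → c :* s := con ½ :* (con 2ℚ :* (c :* s))) ≋-refl coshS sinhS)
                      (⊛-congˡ (const ½) sinh-double)
    where open Series-Solver

  sinh⊛sinh : sinhS ⊛ sinhS ≋ const ½ ⊛ (C₂ ⊕ ⊝ one)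
  sinh⊛sinh = begin
    s ⊛ s
      ≈⟨ solve 3 (λ c s o → s :* s := con ½ :* ((c :* c :+ s :* s) :+ :- (c :* c :+ :- (s :* s)))) ≋-refl c s one ⟩
    const ½ ⊛ (((c ⊛ c) ⊕ (s ⊛ s)) ⊕ ⊝ ((c ⊛ c) ⊕ ⊝ (s ⊛ s)))
      ≈⟨ ⊛-congˡ (const ½) (⊕-cong cosh-double (⊝-cong (cosh²-sinh² cosh-sinh))) ⟩
    const ½ ⊛ (C₂ ⊕ ⊝ one)
      ∎
    where
    open ≋-Reasoning
    open Series-Solver
    c = coshS
    s = sinhS

  rescale-Q-suc : ∀ k → rescale 2ℚ (Q (suc k)) ≋
    (C₂ ⊛ rescale 2ℚ (Q k)) ⊕ ((const 3ℚ ⊛ (S₂ ⊛ rescale 2ℚ (∂ (Q k))))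
                              ⊕ (const 2ℚ ⊛ ((C₂ ⊕ ⊝ one) ⊛ rescale 2ℚ (∂ (∂ (Q k))))))
  rescale-Q-suc k =
    ≋-trans (rescale-⊕ 2ℚ (coshS ⊛ q) _) (⊕-cong first (≋-trans (rescale-⊕ 2ℚ (const 3ℚ ⊛ (sinhS ⊛ ∂ q)) _) (⊕-cong second third)))
    where
    q = Q k
    rescale-const-⊛ : ∀ c f → rescale 2ℚ (const c ⊛ f) ≋ const c ⊛ rescale 2ℚ f
    rescale-const-⊛ c f = ≋-trans (rescale-⊛ 2ℚ (const c) f) (⊛-congʳ (rescale 2ℚ f) (rescale-const 2ℚ c))
    first : rescale 2ℚ (coshS ⊛ q) ≋ C₂ ⊛ rescale 2ℚ q
    first = rescale-⊛ 2ℚ coshS q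
    second : rescale 2ℚ (const 3ℚ ⊛ (sinhS ⊛ ∂ q)) ≋ const 3ℚ ⊛ (S₂ ⊛ rescale 2ℚ (∂ q))
    second = ≋-trans (rescale-const-⊛ 3ℚ (sinhS ⊛ ∂ q)) (⊛-congˡ (const 3ℚ) (rescale-⊛ 2ℚ sinhS (∂ q)))
    third : rescale 2ℚ (const 2ℚ ⊛ ((coshS ⊕ ⊝ one) ⊛ ∂ (∂ q))) ≋ const 2ℚ ⊛ ((C₂ ⊕ ⊝ one) ⊛ rescale 2ℚ (∂ (∂ q)))
    third = ≋-trans (rescale-const-⊛ 2ℚ ((coshS ⊕ ⊝ one) ⊛ ∂ (∂ q)))
      (⊛-congˡ (const 2ℚ) (≋-trans (rescale-⊛ 2ℚ (coshS ⊕ ⊝ one) (∂ (∂ q)))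
        (⊛-congʳ (rescale 2ℚ (∂ (∂ q))) (≋-trans (rescale-⊕ 2ℚ coshS (⊝ one))
          (⊕-congˡ C₂ (≋-trans (rescale-⊝ 2ℚ one) (⊝-cong (rescale-one 2ℚ))))))))

  D-series-even : ∀ k → D-series (2 ℕ.* k) ≋ rescale 2ℚ (Q k)
  D-series-even zero    = ≋-sym (rescale-one 2ℚ)
  D-series-even (suc k) = begin
    D-series (2 ℕ.* suc k)
      ≈⟨ ≋-reflexive (cong D-series (ℕ.*-suc 2 k)) ⟩
    D-series (suc (suc (2 ℕ.* k)))
      ≈⟨ D-series-suc-suc (2 ℕ.* k) ⟩
    (((coshS ⊛ coshS) ⊕ (sinhS ⊛ sinhS)) ⊛ p) ⊕ ((const 3ℚ ⊛ ((coshS ⊛ sinhS) ⊛ ∂ p)) ⊕ ((sinhS ⊛ sinhS) ⊛ ∂ (∂ p)))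
      ≈⟨ ⊕-cong (⊛-cong cosh-double (D-series-even k))
                (⊕-cong (⊛-congˡ (const 3ℚ) (⊛-cong cosh⊛sinh ∂p)) (⊛-cong sinh⊛sinh ∂∂p)) ⟩
    (C₂ ⊛ q) ⊕ ((const 3ℚ ⊛ ((const ½ ⊛ S₂) ⊛ (const 2ℚ ⊛ q′))) ⊕ ((const ½ ⊛ (C₂ ⊕ ⊝ one)) ⊛ (const 2ℚ ⊛ (const 2ℚ ⊛ q″))))
      ≈⟨ solve 6 (λ C S q q′ q″ o → C :* q :+ (con 3ℚ :* ((con ½ :* S) :* (con 2ℚ :* q′)) :+ (con ½ :* (C :+ :- o)) :* (con 2ℚ :* (con 2ℚ :* q″)))
                                 := C :* q :+ (con 3ℚ :* (S :* q′) :+ con 2ℚ :* ((C :+ :- o) :* q″))) ≋-refl C₂ S₂ q q′ q″ one ⟩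
    (C₂ ⊛ q) ⊕ ((const 3ℚ ⊛ (S₂ ⊛ q′)) ⊕ (const 2ℚ ⊛ ((C₂ ⊕ ⊝ one) ⊛ q″)))
      ≈⟨ rescale-Q-suc k ⟨
    rescale 2ℚ (Q (suc k))
      ∎
    where
    open ≋-Reasoning
    open Series-Solver
    p = D-series (2 ℕ.* k)
    q = rescale 2ℚ (Q k)
    q′ = rescale 2ℚ (∂ (Q k))
    q″ = rescale 2ℚ (∂ (∂ (Q k)))
    ∂p : ∂ p ≋ const 2ℚ ⊛ q′
    ∂p = ≋-trans (∂-cong (D-series-even k)) (∂-rescale 2ℚ (Q k))
    ∂∂p : ∂ (∂ p) ≋ const 2ℚ ⊛ (const 2ℚ ⊛ q″)
    ∂∂p = ≋-trans (∂-cong ∂p) (≋-trans (∂-const-⊛ 2ℚ q′) (⊛-congˡ (const 2ℚ) (∂-rescale 2ℚ (∂ (Q k)))))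

  -- Integrality of n! · f n

  IsHurwitzAt : ℕ → Series → Set
  IsHurwitzAt n f = ∃[ z ] ℕ→ℚ (n !) * f n ≡ ℤ→ℚ z

  IsHurwitz : Series → Set
  IsHurwitz f = ∀ n → IsHurwitzAt n f

  !-∂ : ∀ f n → ℕ→ℚ (suc n !) * f (suc n) ≡ ℕ→ℚ (n !) * ∂ f n
  !-∂ f n = begin
    ℕ→ℚ (suc n !) * f (suc n)                 ≡⟨ cong (_* f (suc n)) (ℕ→ℚ-* (suc n) (n !)) ⟩
    ℕ→ℚ (suc n) * ℕ→ℚ (n !) * f (suc n)       ≡⟨ *-assoc (ℕ→ℚ (suc n)) (ℕ→ℚ (n !)) (f (suc n)) ⟩
    ℕ→ℚ (suc n) * (ℕ→ℚ (n !) * f (suc n))     ≡⟨ ℚ-*.x∙yz≈y∙xz (ℕ→ℚ (suc n)) (ℕ→ℚ (n !)) (f (suc n)) ⟩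
    ℕ→ℚ (n !) * ∂ f n                         ∎
    where open ≡-Reasoning

  IsHurwitzAt-∂ : ∀ f n → IsHurwitzAt (suc n) f → IsHurwitzAt n (∂ f)
  IsHurwitzAt-∂ f n (z , eq) = z , trans (sym (!-∂ f n)) eq

  IsHurwitz-∂ : ∀ f → IsHurwitz f → IsHurwitz (∂ f)
  IsHurwitz-∂ f hf n = IsHurwitzAt-∂ f n (hf (suc n))

  IsHurwitz-⊕ : ∀ f g → IsHurwitz f → IsHurwitz g → IsHurwitz (f ⊕ g)
  IsHurwitz-⊕ f g hf hg n = sum (hf n) (hg n)
    where
    sum : IsHurwitzAt n f → IsHurwitzAt n g → IsHurwitzAt n (f ⊕ g)
    sum (a , eqa) (b , eqb) = a ℤ.+ b ,
      trans (*-distribˡ-+ (ℕ→ℚ (n !)) (f n) (g n)) (trans (cong₂ _+_ eqa eqb) (sym (ℤ→ℚ-+ a b)))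

  IsHurwitz-⊝ : ∀ f → IsHurwitz f → IsHurwitz (⊝ f)
  IsHurwitz-⊝ f hf n = negation (hf n)
    where
    negation : IsHurwitzAt n f → IsHurwitzAt n (⊝ f)
    negation (a , eqa) = ℤ.- a , trans (sym (neg-distribʳ-* (ℕ→ℚ (n !)) (f n))) (trans (cong ℚ.-_ eqa) (sym (ℤ→ℚ-neg a)))

  IsHurwitz-one : IsHurwitz one
  IsHurwitz-one zero    = + 1 , refl
  IsHurwitz-one (suc n) = + 0 , *-zeroʳ (ℕ→ℚ (suc n !))

  IsHurwitz-const : ∀ z → IsHurwitz (const (ℤ→ℚ z))
  IsHurwitz-const z zero    = z , trans (*-identityˡ (ℤ→ℚ z * 1ℚ)) (*-identityʳ (ℤ→ℚ z))
  IsHurwitz-const z (suc n) = + 0 , trans (cong (ℕ→ℚ (suc n !) *_) (*-zeroʳ (ℤ→ℚ z))) (*-zeroʳ (ℕ→ℚ (suc n !)))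

  -- Induction on n through the Leibniz rule, as n! · ∂ f n = (n + 1)! · f (n + 1).
  IsHurwitz-⊛ : ∀ f g → IsHurwitz f → IsHurwitz g → IsHurwitz (f ⊛ g)
  IsHurwitz-⊛ f g hf hg zero = product (hf 0) (hg 0)
    where
    open ≡-Reasoning
    product : IsHurwitzAt 0 f → IsHurwitzAt 0 g → IsHurwitzAt 0 (f ⊛ g)
    product (a , eqa) (b , eqb) = a ℤ.* b , (begin
      1ℚ * (f 0 * g 0 + 0ℚ)
        ≡⟨ *-identityˡ (f 0 * g 0 + 0ℚ) ⟩
      f 0 * g 0 + 0ℚ
        ≡⟨ +-identityʳ (f 0 * g 0) ⟩
      f 0 * g 0
        ≡⟨ cong₂ _*_ (trans (sym (*-identityˡ (f 0))) eqa) (trans (sym (*-identityˡ (g 0))) eqb) ⟩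
      ℤ→ℚ a * ℤ→ℚ b
        ≡⟨ ℤ→ℚ-* a b ⟨
      ℤ→ℚ (a ℤ.* b)
        ∎)
  IsHurwitz-⊛ f g hf hg (suc n) =
    leibniz (IsHurwitz-⊛ (∂ f) g (IsHurwitz-∂ f hf) hg n) (IsHurwitz-⊛ f (∂ g) hf (IsHurwitz-∂ g hg) n)
    where
    open ≡-Reasoning
    leibniz : IsHurwitzAt n (∂ f ⊛ g) → IsHurwitzAt n (f ⊛ ∂ g) → IsHurwitzAt (suc n) (f ⊛ g)
    leibniz (a , eqa) (b , eqb) = a ℤ.+ b , (begin
      ℕ→ℚ (suc n !) * (f ⊛ g) (suc n)                      ≡⟨ !-∂ (f ⊛ g) n ⟩
      ℕ→ℚ (n !) * ∂ (f ⊛ g) n                              ≡⟨ cong (ℕ→ℚ (n !) *_) (at (∂-⊛ f g) n) ⟩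
      ℕ→ℚ (n !) * ((∂ f ⊛ g) n + (f ⊛ ∂ g) n)              ≡⟨ *-distribˡ-+ (ℕ→ℚ (n !)) ((∂ f ⊛ g) n) ((f ⊛ ∂ g) n) ⟩
      ℕ→ℚ (n !) * (∂ f ⊛ g) n + ℕ→ℚ (n !) * (f ⊛ ∂ g) n    ≡⟨ cong₂ _+_ eqa eqb ⟩
      ℤ→ℚ a + ℤ→ℚ b                                        ≡⟨ ℤ→ℚ-+ a b ⟨
      ℤ→ℚ (a ℤ.+ b)                                        ∎)

  IsHurwitz-cosh-sinh : IsHurwitz coshS × IsHurwitz sinhS
  IsHurwitz-cosh-sinh = (λ n → proj₁ (at-both n)) , (λ n → proj₂ (at-both n))
    where
    shift-∂ : ∀ f g n → ∂ f ≋ g → IsHurwitzAt n g → IsHurwitzAt (suc n) f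
    shift-∂ f g n ∂f≋g (z , eq) = z , trans (!-∂ f n) (trans (cong (ℕ→ℚ (n !) *_) (at ∂f≋g n)) eq)
    at-both : ∀ n → IsHurwitzAt n coshS × IsHurwitzAt n sinhS
    at-both zero    = (+ 1 , refl) , (+ 0 , refl)
    at-both (suc n) = shift-∂ coshS sinhS n ∂-coshS (proj₂ (at-both n)) , shift-∂ sinhS coshS n ∂-sinhS (proj₁ (at-both n))

  IsHurwitz-Q : ∀ k → IsHurwitz (Q k)
  IsHurwitz-Q zero    = IsHurwitz-one
  IsHurwitz-Q (suc k) = IsHurwitz-⊕ (c ⊛ q) (a ⊕ b) (IsHurwitz-⊛ c q hc hq) (IsHurwitz-⊕ a b ha hb)
    where
    c = coshS
    s = sinhS
    q = Q k
    a = const 3ℚ ⊛ (s ⊛ ∂ q)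
    b = const 2ℚ ⊛ ((c ⊕ ⊝ one) ⊛ ∂ (∂ q))
    hc = proj₁ IsHurwitz-cosh-sinh
    hs = proj₂ IsHurwitz-cosh-sinh
    hq = IsHurwitz-Q k
    ha : IsHurwitz a
    ha = IsHurwitz-⊛ (const 3ℚ) (s ⊛ ∂ q) (IsHurwitz-const (+ 3)) (IsHurwitz-⊛ s (∂ q) hs (IsHurwitz-∂ q hq))
    hb : IsHurwitz b
    hb = IsHurwitz-⊛ (const 2ℚ) ((c ⊕ ⊝ one) ⊛ ∂ (∂ q)) (IsHurwitz-const (+ 2))
           (IsHurwitz-⊛ (c ⊕ ⊝ one) (∂ (∂ q)) (IsHurwitz-⊕ c (⊝ one) hc (IsHurwitz-⊝ one IsHurwitz-one))
             (IsHurwitz-∂ (∂ q) (IsHurwitz-∂ q hq)))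

  2ℚ^ℚ : ∀ n → 2ℚ ^ℚ n ≡ ℕ→ℚ (2 ^ n)
  2ℚ^ℚ zero    = refl
  2ℚ^ℚ (suc n) = trans (cong (2ℚ *_) (2ℚ^ℚ n)) (sym (ℕ→ℚ-* 2 (2 ^ n)))

  D-neg-even-divisible : ∀ N k → ∃[ z ] D N (ℤ.- (+ (2 ℕ.* k))) ≡ ℤ→ℚ z * ℕ→ℚ (2 ^ N)
  D-neg-even-divisible N k = divisible (IsHurwitz-Q k N)
    where
    open ≡-Reasoning
    divisible : IsHurwitzAt N (Q k) → ∃[ z ] D N (ℤ.- (+ (2 ℕ.* k))) ≡ ℤ→ℚ z * ℕ→ℚ (2 ^ N)
    divisible (z , eq) = z , (begin
      D N (ℤ.- (+ (2 ℕ.* k)))                   ≡⟨ D≡D-series N (2 ℕ.* k) ⟩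
      ℕ→ℚ (N !) * D-series (2 ℕ.* k) N          ≡⟨ cong (ℕ→ℚ (N !) *_) (at (D-series-even k) N) ⟩
      ℕ→ℚ (N !) * (2ℚ ^ℚ N * Q k N)             ≡⟨ ℚ-*.x∙yz≈xz∙y (ℕ→ℚ (N !)) (2ℚ ^ℚ N) (Q k N) ⟩
      ℕ→ℚ (N !) * Q k N * 2ℚ ^ℚ N               ≡⟨ cong₂ _*_ eq (2ℚ^ℚ N) ⟩
      ℤ→ℚ z * ℕ→ℚ (2 ^ N)                       ∎)

open Polycosecant using (D-neg-even-divisible)
open import Defs
open import Data.Nat using (ℕ; _≤_; _*_; _^_)
open import Data.Integer using (ℤ; +_; -_)
open import Data.Rational using (ℚ) renaming (_*_ to _*ℚ_)
open import Data.Product using (∃-syntax)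
open import Relation.Binary.PropositionalEquality using (_≡_)

proposition3p10 : (n k : ℕ) → 1 ≤ n → 1 ≤ k →
    ∃[ z ] D (2 * n) (- (+ (2 * k))) ≡ ℤ→ℚ z *ℚ ℕ→ℚ (2 ^ (2 * n))
proposition3p10 n k _ _ = D-neg-even-divisible (2 * n) k
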